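{- Let $d\ge 1$, $n \geq 2d+3$, and let $M$ be a missing $d$-face of $C_{2d + 1}(n)$. Then $(\Delta_{2d+2})^{\leq d}$ is a minor of $\mathcal{C}(\partial C_{2d + 1}(n))^{\leq d} \cup \{M\}$.
   Context: $C_{2d+1}(n)$ is the cyclic $(2d+1)$-polytope with $n$ vertices (convex hull of $n$ distinct points on the moment curve $t\mapsto(t,\dots,t^{2d+1})$), vertices identified with $[n]$ in order; $\mathcal{C}(\partial C_{2d+1}(n))$ is its boundary complex (vertex sets of proper faces) and $K^{\le d}$ denotes the $d$-skeleton. A missing $d$-face of $C_{2d+1}(n)$ is a $(d+1)$-subset of $[n]$ that is not the vertex set of a face but all of whose proper subsets are. $(\Delta_{2d+2})^{\le d}$ is the complex of all subsets of size at most $d+1$ of a $(2d+3)$-element set. Minors (Nevo): for simplicial complexes $L,K$, a deletion replaces $K$ by a subcomplex $L$; an admissible contraction identifies two distinct vertices $u,v$ of $K$ that are not both contained in any missing $k$-face of $K$ with $k\le\dim K$ (a missing $k$-face being a $(k+1)$-set of vertices not in $K$ all of whose proper subsets are in $K$), yielding $L=\{F\in K: u\notin F\}\cup\{F\cup\{v\}: F\cup\{u\}\in K\}$. $L$ is a minor of $K$ if it arises from $K$ by a finite sequence of deletions and admissible contractions (up to isomorphism). -}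

module Defs where

open import Level using (Level)
open import Data.Nat as ℕ using (ℕ; zero; suc; _≤_)
open import Data.Fin using (Fin; zero; suc; toℕ)
open import Data.Fin.Subset using (Subset; _∈_; _∉_; _⊆_; _⊂_; ∣_∣; ⁅_⁆; _∪_; ⊤)
open import Data.Integer using (+_)
open import Data.Rational using (ℚ; 0ℚ; _+_; _*_; _<_; _/_)
open import Data.Product using (Σ; ∃; _×_; _,_)
open import Data.Sum using (_⊎_)
open import Relation.Nullary using (¬_)
open import Relation.Binary.PropositionalEquality using (_≡_; _≢_)
open import Function.Bundles using (_⇔_)
open import Function.Definitions using (Injective)

Family : ℕ → Set₁
Family n = Subset n → Set

IsComplex : ∀ {n} → Family n → Set
IsComplex K = ∀ {S T} → T ⊆ S → K S → K T

_⊑_ : ∀ {n} → Family n → Family n → Set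
L ⊑ K = ∀ S → L S → K S

IsVertex : ∀ {n} → Family n → Fin n → Set
IsVertex K v = K ⁅ v ⁆

MissingFace : ∀ {n} → Family n → ℕ → Subset n → Set
MissingFace K k S = (∣ S ∣ ≡ suc k) × ¬ K S × (∀ T → T ⊂ S → K T)

-- k ≤ dim K  (dim K = max{|F| : F ∈ K} - 1)
LeDim : ∀ {n} → ℕ → Family n → Set
LeDim k K = ∃ λ F → K F × suc k ≤ ∣ F ∣

AdmissiblePair : ∀ {n} → Family n → Fin n → Fin n → Set
AdmissiblePair K u v =
  u ≢ v × IsVertex K u × IsVertex K v ×
  (∀ k S → LeDim k K → MissingFace K k S → ¬ (u ∈ S × v ∈ S))

Contraction : ∀ {n} → Family n → Fin n → Fin n → Family n
Contraction K u v S =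
  (u ∉ S × K S) ⊎ (∃ λ F → u ∉ F × K (F ∪ ⁅ u ⁆) × S ≡ F ∪ ⁅ v ⁆)

data Step {n} (K : Family n) (L : Family n) : Set₁ where
  deletion    : IsComplex L → L ⊑ K → Step K L
  contraction : (u v : Fin n) → AdmissiblePair K u v →
                (∀ S → L S ⇔ Contraction K u v S) → Step K L

data Steps {n} : Family n → Family n → Set₁ where
  done : ∀ {K} → Steps K K
  step : ∀ {K L M} → Step K L → Steps L M → Steps K M

Image : ∀ {m n} → (Fin m → Fin n) → Subset m → Subset n → Set
Image f T S = ∀ j → (j ∈ S) ⇔ (∃ λ i → i ∈ T × f i ≡ j)

Isomorphic : ∀ {m n} → Family n → Family m → Set
Isomorphic {m} {n} L T =
  ∃ λ (f : Fin m → Fin n) → Injective _≡_ _≡_ f ×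
    (∀ S → L S ⇔ (∃ λ U → T U × Image f U S))

IsMinor : ∀ {m n} → Family m → Family n → Set₁
IsMinor T K = ∃ λ L → Steps K L × Isomorphic L T

-- Cyclic polytope C_{D}(n): vertex i ↦ (t, t², …, t^D), t = i + 1.

ℕtoℚ : ℕ → ℚ
ℕtoℚ k = (+ k) / 1

sumFin : ∀ {m} → (Fin m → ℚ) → ℚ
sumFin {zero}  f = 0ℚ
sumFin {suc m} f = f zero + sumFin (λ j → f (suc j))

momentCoord : ∀ {n} → Fin n → ∀ {D} → Fin D → ℚ
momentCoord i j = ℕtoℚ ((suc (toℕ i)) ℕ.^ (suc (toℕ j)))

eval : ∀ {D n} → (Fin D → ℚ) → Fin n → ℚ
eval {D} c i = sumFin (λ j → c j * momentCoord i j)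

IsFace : (D n : ℕ) → Subset n → Set
IsFace D n S = ∃ λ (c : Fin D → ℚ) → ∃ λ (b : ℚ) →
  ∀ i → (i ∈ S → eval c i ≡ b) × (i ∉ S → eval c i < b)

BoundaryComplex : (D n : ℕ) → Family n
BoundaryComplex D n S = IsFace D n S × S ≢ ⊤

Skeleton : ∀ {n} → ℕ → Family n → Family n
Skeleton k K S = K S × ∣ S ∣ ≤ suc k

AddFace : ∀ {n} → Family n → Subset n → Family n
AddFace K M S = K S ⊎ S ≡ M

-- (Δ_{m-1})^{≤ k}: all subsets of size ≤ k+1 of Fin m
SimplexSkeleton : (m k : ℕ) → Family m
SimplexSkeleton m k S = ∣ S ∣ ≤ suc k

-- For P ⊆ [n] let A_P consist of the subsets of P with at most d elements, the
-- (d+1)-subsets of P that are anchored in P (they contain two elements consecutive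
-- in P, or the least or greatest element of P), and M.  Every anchored (d+1)-subset
-- of [n] is a face of C_{2d+1}(n): a polynomial of degree at most 2d+1 vanishing
-- exactly there is given by a linear or quadratic factor times squares, so A_[n] is
-- a subcomplex of the given complex.  Contracting a vertex u ∉ M of P into a
-- neighbour in P turns A_P into A_{P-u}.  Since M is not a face, it has no two
-- consecutive elements and avoids 1 and n, so P can be shrunk to
-- F = {1} ∪ M ∪ (M + 1) with 2d+3 elements, in which M is the only (d+1)-subset
-- that is not anchored; hence A_F is the full d-skeleton of a (2d+2)-simplex.

module Submission where

open import Defs
open import Data.Nat using (ℕ; _≤_; _+_; _*_)
open import Data.Fin.Subset using (Subset)

open import Data.Nat as ℕ using (zero; suc; z≤n; s≤s)
import Data.Nat.Properties as ℕ
import Data.Nat.Induction as ℕ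
open import Data.Fin as Fin using (Fin; zero; suc; toℕ; _<_; _>_)
import Data.Fin.Properties as Fin
open import Data.Fin.Induction using (<-wellFounded; >-wellFounded)
open import Data.Fin.Subset using (_∈_; _∉_; _⊆_; _⊂_; ∣_∣; ⁅_⁆; _∪_; _─_; _-_; ⊤; outside; inside)
open import Data.Bool.Base using (Bool)
open import Data.Integer as ℤ using (ℤ; +[1+_]; -[1+_]; 0ℤ; 1ℤ; -1ℤ)
import Data.Integer.Properties as ℤ
open import Data.Integer.Tactic.RingSolver using (solve-∀)
import Data.Nat.Tactic.RingSolver as ℕ-Solver
open import Data.Rational as ℚ using (ℚ; mkℚ; _/_)
import Data.Rational.Properties as ℚ
open import Data.Nat.Divisibility using (∣1⇒≡1)
open import Data.List.Base using (List; []; _∷_; length; drop)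
open import Data.Fin.Subset.Properties
open import Data.Vec.Base using ([]; _∷_; here; there)
open import Data.Product using (∃; _×_; _,_; proj₁; proj₂)
open import Data.Sum using (_⊎_; inj₁; inj₂)
open import Data.Empty using (⊥-elim)
open import Induction.WellFounded using (Acc; acc)
import Relation.Binary.Construct.On as On
open import Relation.Nullary using (¬_; Dec; yes; no; ¬?; _×-dec_)
open import Relation.Binary.Definitions using (tri<; tri≈; tri>)
import Relation.Binary.PropositionalEquality
open Relation.Binary.PropositionalEquality using (_≡_; _≢_; refl; sym; trans; cong; cong₂; subst; subst₂)
open import Function.Base using (_∘_; _on_)
open import Function.Bundles using (_⇔_; mk⇔; Equivalence)
open import Function.Definitions using (Injective)
open Relation.Binary.PropositionalEquality.≡-Reasoning

private variable
  m n d k : ℕ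
  a b x y u v w : Fin n
  p q M P Q S T F : Subset n
  U V : Subset m

x∈p─q⇒x∉q : ∀ (p q : Subset n) → x ∈ p ─ q → x ∉ q
x∈p─q⇒x∉q (_ ∷ p) (outside ∷ q) here ()
x∈p─q⇒x∉q (_ ∷ p) (_ ∷ q) (there x∈) (there x∈q) = x∈p─q⇒x∉q p q x∈ x∈q

x∈p-y⇒x≢y : x ∈ p - y → x ≢ y
x∈p-y⇒x≢y {p = p} {y = y} x∈ refl = x∈p─q⇒x∉q p ⁅ y ⁆ x∈ (x∈⁅x⁆ y)

x∈p-y⇒x∈p : x ∈ p - y → x ∈ p
x∈p-y⇒x∈p {p = p} {y = y} = p─q⊆p p ⁅ y ⁆

x∈p⇒x∈p-y⊎x≡y : x ∈ p → x ∈ p - y ⊎ x ≡ y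
x∈p⇒x∈p-y⊎x≡y {x = x} {y = y} x∈p with x Fin.≟ y
... | yes x≡y = inj₂ x≡y
... | no x≢y = inj₁ (x∈p∧x≢y⇒x∈p-y x∈p x≢y)

x∈p∪⁅x⁆ : ∀ (p : Subset n) → x ∈ p ∪ ⁅ x ⁆
x∈p∪⁅x⁆ {x = x} p = x∈p∪q⁺ (inj₂ (x∈⁅x⁆ x))

x∈p⇒x∈p∪⁅y⁆ : x ∈ p → x ∈ p ∪ ⁅ y ⁆
x∈p⇒x∈p∪⁅y⁆ x∈p = x∈p∪q⁺ (inj₁ x∈p)

x∈p∪⁅y⁆⁻ : ∀ (p : Subset n) → x ∈ p ∪ ⁅ y ⁆ → x ∈ p ⊎ x ≡ y
x∈p∪⁅y⁆⁻ {y = y} p x∈ with x∈p∪q⁻ p ⁅ y ⁆ x∈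
... | inj₁ x∈p = inj₁ x∈p
... | inj₂ x∈⁅y⁆ = inj₂ (x∈⁅y⁆⇒x≡y y x∈⁅y⁆)

x∉p⇒∣p∪⁅x⁆∣≡1+∣p∣ : ∀ (p : Subset n) → x ∉ p → ∣ p ∪ ⁅ x ⁆ ∣ ≡ suc ∣ p ∣
x∉p⇒∣p∪⁅x⁆∣≡1+∣p∣ {x = zero}  (outside ∷ p) _   = cong (λ q → suc ∣ q ∣) (∪-identityʳ p)
x∉p⇒∣p∪⁅x⁆∣≡1+∣p∣ {x = zero}  (inside ∷ p)  x∉p = ⊥-elim (x∉p here)
x∉p⇒∣p∪⁅x⁆∣≡1+∣p∣ {x = suc x} (outside ∷ p) x∉p = x∉p⇒∣p∪⁅x⁆∣≡1+∣p∣ p (x∉p ∘ there)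
x∉p⇒∣p∪⁅x⁆∣≡1+∣p∣ {x = suc x} (inside ∷ p)  x∉p = cong suc (x∉p⇒∣p∪⁅x⁆∣≡1+∣p∣ p (x∉p ∘ there))

x∈p⇒p∪⁅x⁆≡p : ∀ (p : Subset n) → x ∈ p → p ∪ ⁅ x ⁆ ≡ p
x∈p⇒p∪⁅x⁆≡p {x = x} p x∈p = ⊆-antisym ⊆p x∈p⇒x∈p∪⁅y⁆
  where
  ⊆p : p ∪ ⁅ x ⁆ ⊆ p
  ⊆p y∈ with x∈p∪⁅y⁆⁻ p y∈
  ... | inj₁ y∈p = y∈p
  ... | inj₂ refl = x∈p

x∈p⇒p-x∪⁅x⁆≡p : ∀ (p : Subset n) → x ∈ p → (p - x) ∪ ⁅ x ⁆ ≡ p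
x∈p⇒p-x∪⁅x⁆≡p {x = x} p x∈p = ⊆-antisym ⊆p ⊇p
  where
  ⊆p : (p - x) ∪ ⁅ x ⁆ ⊆ p
  ⊆p y∈ with x∈p∪⁅y⁆⁻ (p - x) y∈
  ... | inj₁ y∈p-x = x∈p-y⇒x∈p y∈p-x
  ... | inj₂ refl = x∈p
  ⊇p : p ⊆ (p - x) ∪ ⁅ x ⁆
  ⊇p {y} y∈p with y Fin.≟ x
  ... | yes refl = x∈p∪⁅x⁆ (p - x)
  ... | no y≢x = x∈p⇒x∈p∪⁅y⁆ (x∈p∧x≢y⇒x∈p-y y∈p y≢x)

x∈p⇒1+∣p-x∣≡∣p∣ : ∀ (p : Subset n) → x ∈ p → suc ∣ p - x ∣ ≡ ∣ p ∣
x∈p⇒1+∣p-x∣≡∣p∣ {x = x} p x∈p = begin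
  suc ∣ p - x ∣       ≡⟨ x∉p⇒∣p∪⁅x⁆∣≡1+∣p∣ (p - x) (λ x∈ → x∈p-y⇒x≢y x∈ refl) ⟨
  ∣ (p - x) ∪ ⁅ x ⁆ ∣ ≡⟨ cong ∣_∣ (x∈p⇒p-x∪⁅x⁆≡p p x∈p) ⟩
  ∣ p ∣               ∎

x∈p∧y∉p⇒x≢y : x ∈ p → y ∉ p → x ≢ y
x∈p∧y∉p⇒x≢y x∈p y∉p refl = y∉p x∈p

x∈p⇒⁅x⁆⊆p : x ∈ p → ⁅ x ⁆ ⊆ p
x∈p⇒⁅x⁆⊆p {x = x} {p = p} x∈p z∈ = subst (_∈ p) (sym (x∈⁅y⁆⇒x≡y x z∈)) x∈p

⁅x⁆⊂p : x ∈ p → y ∈ p → x ≢ y → ⁅ x ⁆ ⊂ p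
⁅x⁆⊂p {x = x} x∈p y∈p x≢y = x∈p⇒⁅x⁆⊆p x∈p , _ , y∈p , x≢y ∘ sym ∘ x∈⁅y⁆⇒x≡y x

∣p-x∪⁅y⁆∣≡∣p∣ : ∀ (p : Subset n) → x ∈ p → y ∉ p - x → ∣ (p - x) ∪ ⁅ y ⁆ ∣ ≡ ∣ p ∣
∣p-x∪⁅y⁆∣≡∣p∣ p x∈p y∉p-x = trans (x∉p⇒∣p∪⁅x⁆∣≡1+∣p∣ _ y∉p-x) (x∈p⇒1+∣p-x∣≡∣p∣ p x∈p)

p⊆q-x⇒x∉p : p ⊆ q - x → x ∉ p
p⊆q-x⇒x∉p p⊆q-x x∈p = x∈p-y⇒x≢y (p⊆q-x x∈p) refl

p⊆q-x⇒p⊆q : p ⊆ q - x → p ⊆ q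
p⊆q-x⇒p⊆q p⊆q-x = x∈p-y⇒x∈p ∘ p⊆q-x

⊆-or-witness : ∀ (p q : Subset n) → q ⊆ p ⊎ ∃ λ x → x ∈ q × x ∉ p
⊆-or-witness p q with Fin.any? (λ x → (x ∈? q) ×-dec ¬? (x ∈? p))
... | yes witness = inj₂ witness
... | no ∄x = inj₁ q⊆p
  where
  q⊆p : q ⊆ p
  q⊆p {x} x∈q with x ∈? p
  ... | yes x∈p = x∈p
  ... | no x∉p = ⊥-elim (∄x (x , x∈q , x∉p))

p⊆q∧∣q∣≤∣p∣⇒p≡q : p ⊆ q → ∣ q ∣ ≤ ∣ p ∣ → p ≡ q
p⊆q∧∣q∣≤∣p∣⇒p≡q {p = p} {q = q} p⊆q ∣q∣≤∣p∣ with ⊆-or-witness p q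
... | inj₁ q⊆p = ⊆-antisym p⊆q q⊆p
... | inj₂ (x , x∈q , x∉p) = ⊥-elim (ℕ.<⇒≱ (p⊂q⇒∣p∣<∣q∣ (p⊆q , x , x∈q , x∉p)) ∣q∣≤∣p∣)

∣p∪q∣≡∣p∣+∣q∣ : ∀ (p q : Subset n) → (∀ {x} → x ∈ p → x ∉ q) → ∣ p ∪ q ∣ ≡ ∣ p ∣ + ∣ q ∣
∣p∪q∣≡∣p∣+∣q∣ []            []            _       = refl
∣p∪q∣≡∣p∣+∣q∣ (inside ∷ p)  (inside ∷ q)  disjoint = ⊥-elim (disjoint here here)
∣p∪q∣≡∣p∣+∣q∣ (inside ∷ p)  (outside ∷ q) disjoint =
  cong suc (∣p∪q∣≡∣p∣+∣q∣ p q (λ x∈p x∈q → disjoint (there x∈p) (there x∈q)))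
∣p∪q∣≡∣p∣+∣q∣ (outside ∷ p) (inside ∷ q)  disjoint =
  trans (cong suc (∣p∪q∣≡∣p∣+∣q∣ p q (λ x∈p x∈q → disjoint (there x∈p) (there x∈q))))
        (sym (ℕ.+-suc ∣ p ∣ ∣ q ∣))
∣p∪q∣≡∣p∣+∣q∣ (outside ∷ p) (outside ∷ q) disjoint =
  ∣p∪q∣≡∣p∣+∣q∣ p q (λ x∈p x∈q → disjoint (there x∈p) (there x∈q))

Consecutive : Subset n → Fin n → Fin n → Set
Consecutive P a b = a ∈ P × b ∈ P × a < b × (∀ c → c ∈ P → a < c → ¬ c < b)

Least : Subset n → Fin n → Set
Least P a = a ∈ P × (∀ c → c ∈ P → ¬ c < a)

Greatest : Subset n → Fin n → Set
Greatest P a = a ∈ P × (∀ c → c ∈ P → ¬ a < c)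

Neighbours : Subset n → Fin n → Fin n → Set
Neighbours P u v = Consecutive P u v ⊎ Consecutive P v u

>⇒≢ : y > x → y ≢ x
>⇒≢ x<y = Fin.<⇒≢ x<y ∘ sym

consecutive-unique-right : Consecutive P u v → Consecutive P u w → v ≡ w
consecutive-unique-right {v = v} {w = w} (_ , v∈P , u<v , gap-v) (_ , w∈P , u<w , gap-w)
  with Fin.<-cmp v w
... | tri< v<w _ _ = ⊥-elim (gap-w v v∈P u<v v<w)
... | tri≈ _ v≡w _ = v≡w
... | tri> _ _ w<v = ⊥-elim (gap-v w w∈P u<w w<v)

consecutive-unique-left : Consecutive P v u → Consecutive P w u → v ≡ w
consecutive-unique-left {v = v} {w = w} (v∈P , _ , v<u , gap-v) (w∈P , _ , w<u , gap-w)
  with Fin.<-cmp v w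
... | tri< v<w _ _ = ⊥-elim (gap-v w w∈P v<w w<u)
... | tri≈ _ v≡w _ = v≡w
... | tri> _ _ w<v = ⊥-elim (gap-w v v∈P w<v v<u)

least-neighbour : Least P u → Neighbours P u v → Consecutive P u v
least-neighbour _ (inj₁ u⋯v) = u⋯v
least-neighbour {v = v} (_ , minimal) (inj₂ (v∈P , _ , v<u , _)) = ⊥-elim (minimal v v∈P v<u)

greatest-neighbour : Greatest P u → Neighbours P u v → Consecutive P v u
greatest-neighbour _ (inj₂ v⋯u) = v⋯u
greatest-neighbour {v = v} (_ , maximal) (inj₁ (_ , v∈P , u<v , _)) = ⊥-elim (maximal v v∈P u<v)

consecutive-after-removal : u ∈ P → Consecutive (P - u) a b →
  Consecutive P a b ⊎ (Consecutive P a u × Consecutive P u b)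
consecutive-after-removal {u = u} {a = a} {b = b} u∈P (a∈ , b∈ , a<b , gap)
  with a Fin.<? u | u Fin.<? b
... | yes a<u | yes u<b =
  inj₂ ( (x∈p-y⇒x∈p a∈ , u∈P , a<u ,
          λ c c∈P a<c c<u → gap c (x∈p∧x≢y⇒x∈p-y c∈P (Fin.<⇒≢ c<u)) a<c (ℕ.<-trans c<u u<b))
       , (u∈P , x∈p-y⇒x∈p b∈ , u<b ,
          λ c c∈P u<c c<b → gap c (x∈p∧x≢y⇒x∈p-y c∈P (>⇒≢ u<c)) (ℕ.<-trans a<u u<c) c<b))
... | no a≮u | _ = inj₁ (x∈p-y⇒x∈p a∈ , x∈p-y⇒x∈p b∈ , a<b ,
  λ c c∈P a<c c<b → gap c (x∈p∧x≢y⇒x∈p-y c∈P (λ { refl → a≮u a<c })) a<c c<b)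
... | yes _ | no u≮b = inj₁ (x∈p-y⇒x∈p a∈ , x∈p-y⇒x∈p b∈ , a<b ,
  λ c c∈P a<c c<b → gap c (x∈p∧x≢y⇒x∈p-y c∈P (λ { refl → u≮b c<b })) a<c c<b)

least-after-removal : u ∈ P → Least (P - u) a → Least P a ⊎ (Least P u × Consecutive P u a)
least-after-removal {u = u} {a = a} u∈P (a∈ , minimal) with u Fin.<? a
... | yes u<a =
  inj₂ ( (u∈P , λ c c∈P c<u → minimal c (x∈p∧x≢y⇒x∈p-y c∈P (Fin.<⇒≢ c<u)) (ℕ.<-trans c<u u<a))
       , (u∈P , x∈p-y⇒x∈p a∈ , u<a ,
          λ c c∈P u<c c<a → minimal c (x∈p∧x≢y⇒x∈p-y c∈P (>⇒≢ u<c)) c<a))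
... | no u≮a = inj₁ (x∈p-y⇒x∈p a∈ ,
  λ c c∈P c<a → minimal c (x∈p∧x≢y⇒x∈p-y c∈P (λ { refl → u≮a c<a })) c<a)

greatest-after-removal : u ∈ P → Greatest (P - u) a → Greatest P a ⊎ (Greatest P u × Consecutive P a u)
greatest-after-removal {u = u} {a = a} u∈P (a∈ , maximal) with a Fin.<? u
... | yes a<u =
  inj₂ ( (u∈P , λ c c∈P u<c → maximal c (x∈p∧x≢y⇒x∈p-y c∈P (>⇒≢ u<c)) (ℕ.<-trans a<u u<c))
       , (x∈p-y⇒x∈p a∈ , u∈P , a<u ,
          λ c c∈P a<c c<u → maximal c (x∈p∧x≢y⇒x∈p-y c∈P (Fin.<⇒≢ c<u)) a<c))
... | no a≮u = inj₁ (x∈p-y⇒x∈p a∈ ,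
  λ c c∈P a<c → maximal c (x∈p∧x≢y⇒x∈p-y c∈P (λ { refl → a≮u a<c })) a<c)

consecutive-survives-removal : Consecutive P a b → a ≢ u → b ≢ u → Consecutive (P - u) a b
consecutive-survives-removal (a∈P , b∈P , a<b , gap) a≢u b≢u =
  x∈p∧x≢y⇒x∈p-y a∈P a≢u , x∈p∧x≢y⇒x∈p-y b∈P b≢u , a<b , λ c → gap c ∘ x∈p-y⇒x∈p

least-survives-removal : Least P a → a ≢ u → Least (P - u) a
least-survives-removal (a∈P , minimal) a≢u = x∈p∧x≢y⇒x∈p-y a∈P a≢u , λ c → minimal c ∘ x∈p-y⇒x∈p

greatest-survives-removal : Greatest P a → a ≢ u → Greatest (P - u) a
greatest-survives-removal (a∈P , maximal) a≢u = x∈p∧x≢y⇒x∈p-y a∈P a≢u , λ c → maximal c ∘ x∈p-y⇒x∈p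

consecutive-bridge : Consecutive P a u → Consecutive P u b → Consecutive (P - u) a b
consecutive-bridge {P = P} {a = a} {u = u} {b = b} (a∈P , u∈P , a<u , gap-au) (_ , b∈P , u<b , gap-ub) =
  x∈p∧x≢y⇒x∈p-y a∈P (Fin.<⇒≢ a<u) , x∈p∧x≢y⇒x∈p-y b∈P (>⇒≢ u<b) , ℕ.<-trans a<u u<b ,
  λ c c∈ → between c (x∈p-y⇒x∈p c∈) (x∈p-y⇒x≢y c∈)
  where
  between : ∀ c → c ∈ P → c ≢ u → a < c → ¬ c < b
  between c c∈P c≢u a<c c<b with Fin.<-cmp c u
  ... | tri< c<u _ _ = gap-au c c∈P a<c c<u
  ... | tri≈ _ c≡u _ = c≢u c≡u
  ... | tri> _ _ u<c = gap-ub c c∈P u<c c<b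

least-bridge : Least P u → Consecutive P u v → Least (P - u) v
least-bridge {P = P} {u = u} {v = v} (u∈P , minimal) (_ , v∈P , u<v , gap) =
  x∈p∧x≢y⇒x∈p-y v∈P (>⇒≢ u<v) , λ c c∈ → below c (x∈p-y⇒x∈p c∈) (x∈p-y⇒x≢y c∈)
  where
  below : ∀ c → c ∈ P → c ≢ u → ¬ c < v
  below c c∈P c≢u c<v with Fin.<-cmp c u
  ... | tri< c<u _ _ = minimal c c∈P c<u
  ... | tri≈ _ c≡u _ = c≢u c≡u
  ... | tri> _ _ u<c = gap c c∈P u<c c<v

greatest-bridge : Greatest P u → Consecutive P v u → Greatest (P - u) v
greatest-bridge {P = P} {u = u} {v = v} (u∈P , maximal) (v∈P , _ , v<u , gap) =
  x∈p∧x≢y⇒x∈p-y v∈P (Fin.<⇒≢ v<u) , λ c c∈ → above c (x∈p-y⇒x∈p c∈) (x∈p-y⇒x≢y c∈)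
  where
  above : ∀ c → c ∈ P → c ≢ u → ¬ v < c
  above c c∈P c≢u v<c with Fin.<-cmp c u
  ... | tri< c<u _ _ = gap c c∈P v<c c<u
  ... | tri≈ _ c≡u _ = c≢u c≡u
  ... | tri> _ _ u<c = maximal c c∈P u<c

successor : u ∈ P → ∀ w → Acc _<_ w → w ∈ P → u < w → ∃ (Consecutive P u)
successor {u = u} {P = P} u∈P w (acc smaller) w∈P u<w
  with Fin.any? (λ c → (c ∈? P) ×-dec (u Fin.<? c) ×-dec (c Fin.<? w))
... | yes (c , c∈P , u<c , c<w) = successor u∈P c (smaller c<w) c∈P u<c
... | no ∄c = w , u∈P , w∈P , u<w , λ c c∈P u<c c<w → ∄c (c , c∈P , u<c , c<w)

predecessor : u ∈ P → ∀ w → Acc _>_ w → w ∈ P → w < u → ∃ λ v → Consecutive P v u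
predecessor {u = u} {P = P} u∈P w (acc larger) w∈P w<u
  with Fin.any? (λ c → (c ∈? P) ×-dec (w Fin.<? c) ×-dec (c Fin.<? u))
... | yes (c , c∈P , w<c , c<u) = predecessor u∈P c (larger w<c) c∈P c<u
... | no ∄c = w , w∈P , u∈P , w<u , λ c c∈P w<c c<u → ∄c (c , c∈P , w<c , c<u)

neighbour-exists : u ∈ P → w ∈ P → u ≢ w → ∃ (Neighbours P u)
neighbour-exists {u = u} {w = w} u∈P w∈P u≢w with Fin.<-cmp u w
... | tri< u<w _ _ = let v , u⋯v = successor u∈P w (<-wellFounded w) w∈P u<w in v , inj₁ u⋯v
... | tri≈ _ u≡w _ = ⊥-elim (u≢w u≡w)
... | tri> _ _ w<u = let v , v⋯u = predecessor u∈P w (>-wellFounded w) w∈P w<u in v , inj₂ v⋯u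

neighbours-∈ˡ : Neighbours P u v → u ∈ P
neighbours-∈ˡ (inj₁ (u∈P , _)) = u∈P
neighbours-∈ˡ (inj₂ (_ , u∈P , _)) = u∈P

neighbours-∈ʳ : Neighbours P u v → v ∈ P
neighbours-∈ʳ (inj₁ (_ , v∈P , _)) = v∈P
neighbours-∈ʳ (inj₂ (v∈P , _)) = v∈P

neighbours-≢ : Neighbours P u v → u ≢ v
neighbours-≢ (inj₁ (_ , _ , u<v , _)) = Fin.<⇒≢ u<v
neighbours-≢ (inj₂ (_ , _ , v<u , _)) = >⇒≢ v<u

-- Anchored sets and the complexes A_P

data Anchored (P S : Subset n) : Set where
  consecutive : a ∈ S → b ∈ S → Consecutive P a b → Anchored P S
  least       : a ∈ S → Least P a → Anchored P S
  greatest    : a ∈ S → Greatest P a → Anchored P S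

anchored-survives-removal : Anchored P S → u ∉ S → Anchored (P - u) S
anchored-survives-removal (consecutive a∈S b∈S a⋯b) u∉S =
  consecutive a∈S b∈S (consecutive-survives-removal a⋯b (x∈p∧y∉p⇒x≢y a∈S u∉S) (x∈p∧y∉p⇒x≢y b∈S u∉S))
anchored-survives-removal (least a∈S a-least) u∉S =
  least a∈S (least-survives-removal a-least (x∈p∧y∉p⇒x≢y a∈S u∉S))
anchored-survives-removal (greatest a∈S a-greatest) u∉S =
  greatest a∈S (greatest-survives-removal a-greatest (x∈p∧y∉p⇒x≢y a∈S u∉S))

anchored-after-removal : Neighbours P u v → Anchored (P - u) S →
  Anchored P S ⊎ (v ∈ S × Anchored P ((S - v) ∪ ⁅ u ⁆))
anchored-after-removal {S = S} nb (consecutive a∈S b∈S a⋯b@(_ , _ , a<b , _))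
  with consecutive-after-removal (neighbours-∈ˡ nb) a⋯b
... | inj₁ a⋯b′ = inj₁ (consecutive a∈S b∈S a⋯b′)
... | inj₂ (a⋯u , u⋯b) with nb
...   | inj₁ u⋯v with consecutive-unique-right u⋯v u⋯b
...     | refl = inj₂ (b∈S , consecutive (x∈p⇒x∈p∪⁅y⁆ (x∈p∧x≢y⇒x∈p-y a∈S (Fin.<⇒≢ a<b)))
                                          (x∈p∪⁅x⁆ (S - _)) a⋯u)
anchored-after-removal {S = S} nb (consecutive a∈S b∈S a⋯b@(_ , _ , a<b , _))
    | inj₂ (a⋯u , u⋯b) | inj₂ v⋯u with consecutive-unique-left v⋯u a⋯u
...     | refl = inj₂ (a∈S , consecutive (x∈p∪⁅x⁆ (S - _))
                                          (x∈p⇒x∈p∪⁅y⁆ (x∈p∧x≢y⇒x∈p-y b∈S (>⇒≢ a<b)))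
                                          u⋯b)
anchored-after-removal {S = S} nb (least a∈S a-least)
  with least-after-removal (neighbours-∈ˡ nb) a-least
... | inj₁ a-least′ = inj₁ (least a∈S a-least′)
... | inj₂ (u-least , u⋯a) with consecutive-unique-right (least-neighbour u-least nb) u⋯a
...   | refl = inj₂ (a∈S , least (x∈p∪⁅x⁆ (S - _)) u-least)
anchored-after-removal {S = S} nb (greatest a∈S a-greatest)
  with greatest-after-removal (neighbours-∈ˡ nb) a-greatest
... | inj₁ a-greatest′ = inj₁ (greatest a∈S a-greatest′)
... | inj₂ (u-greatest , a⋯u) with consecutive-unique-left (greatest-neighbour u-greatest nb) a⋯u
...   | refl = inj₂ (a∈S , greatest (x∈p∪⁅x⁆ (S - _)) u-greatest)

anchored-contraction : Neighbours P u v → u ∉ F → v ∉ F →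
  Anchored P (F ∪ ⁅ u ⁆) → Anchored (P - u) (F ∪ ⁅ v ⁆)
anchored-contraction {F = F} nb u∉F v∉F (consecutive a∈ b∈ a⋯b@(_ , _ , a<b , _))
  with x∈p∪⁅y⁆⁻ F a∈ | x∈p∪⁅y⁆⁻ F b∈ | nb
... | inj₁ a∈F | inj₁ b∈F | _ =
  consecutive (x∈p⇒x∈p∪⁅y⁆ a∈F) (x∈p⇒x∈p∪⁅y⁆ b∈F)
              (consecutive-survives-removal a⋯b (x∈p∧y∉p⇒x≢y a∈F u∉F) (x∈p∧y∉p⇒x≢y b∈F u∉F))
... | inj₂ refl | inj₂ refl | _ = ⊥-elim (Fin.<⇒≢ a<b refl)
... | inj₂ refl | inj₁ b∈F | inj₁ u⋯v = ⊥-elim (v∉F (subst (_∈ F) (consecutive-unique-right a⋯b u⋯v) b∈F))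
... | inj₂ refl | inj₁ b∈F | inj₂ v⋯u =
  consecutive (x∈p∪⁅x⁆ F) (x∈p⇒x∈p∪⁅y⁆ b∈F) (consecutive-bridge v⋯u a⋯b)
... | inj₁ a∈F | inj₂ refl | inj₂ v⋯u = ⊥-elim (v∉F (subst (_∈ F) (consecutive-unique-left a⋯b v⋯u) a∈F))
... | inj₁ a∈F | inj₂ refl | inj₁ u⋯v =
  consecutive (x∈p⇒x∈p∪⁅y⁆ a∈F) (x∈p∪⁅x⁆ F) (consecutive-bridge a⋯b u⋯v)
anchored-contraction {F = F} nb u∉F v∉F (least a∈ a-least) with x∈p∪⁅y⁆⁻ F a∈
... | inj₁ a∈F = least (x∈p⇒x∈p∪⁅y⁆ a∈F) (least-survives-removal a-least (x∈p∧y∉p⇒x≢y a∈F u∉F))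
... | inj₂ refl = least (x∈p∪⁅x⁆ F) (least-bridge a-least (least-neighbour a-least nb))
anchored-contraction {F = F} nb u∉F v∉F (greatest a∈ a-greatest) with x∈p∪⁅y⁆⁻ F a∈
... | inj₁ a∈F = greatest (x∈p⇒x∈p∪⁅y⁆ a∈F) (greatest-survives-removal a-greatest (x∈p∧y∉p⇒x≢y a∈F u∉F))
... | inj₂ refl = greatest (x∈p∪⁅x⁆ F) (greatest-bridge a-greatest (greatest-neighbour a-greatest nb))

neighbours-anchored : Neighbours P u v → u ∈ S → v ∈ S → Anchored P S
neighbours-anchored (inj₁ u⋯v) u∈S v∈S = consecutive u∈S v∈S u⋯v
neighbours-anchored (inj₂ v⋯u) u∈S v∈S = consecutive v∈S u∈S v⋯u

data Admitted (d : ℕ) (M P S : Subset n) : Set where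
  small    : ∣ S ∣ ≤ d → Admitted d M P S
  anchored : Anchored P S → Admitted d M P S
  missing  : S ≡ M → Admitted d M P S

AnchoredComplex : ℕ → Subset n → Subset n → Family n
AnchoredComplex d M P S = S ⊆ P × ∣ S ∣ ≤ suc d × Admitted d M P S

anchoredComplex-isComplex : IsComplex (AnchoredComplex d M P)
anchoredComplex-isComplex {d = d} {M = M} {P = P} {S} {T} T⊆S (S⊆P , ∣S∣≤1+d , admitted)
  with ∣ T ∣ ℕ.≤? d
... | yes ∣T∣≤d = S⊆P ∘ T⊆S , ℕ.≤-trans (p⊆q⇒∣p∣≤∣q∣ T⊆S) ∣S∣≤1+d , small ∣T∣≤d
... | no ∣T∣≰d = subst (AnchoredComplex d M P) (sym T≡S) (S⊆P , ∣S∣≤1+d , admitted)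
  where
  T≡S : T ≡ S
  T≡S = p⊆q∧∣q∣≤∣p∣⇒p≡q T⊆S (ℕ.≤-trans ∣S∣≤1+d (ℕ.≰⇒> ∣T∣≰d))

neighbours-admissible : 1 ≤ d → Neighbours P u v → AdmissiblePair (AnchoredComplex d M P) u v
neighbours-admissible {d = d} {P = P} {u = u} {v = v} {M = M} 1≤d nb =
  neighbours-≢ nb , vertex (neighbours-∈ˡ nb) , vertex (neighbours-∈ʳ nb) , not-in-missing-face
  where
  vertex : x ∈ P → IsVertex (AnchoredComplex d M P) x
  vertex {x} x∈P = x∈p⇒⁅x⁆⊆p x∈P , ℕ.m≤n⇒m≤1+n ∣⁅x⁆∣≤d , small ∣⁅x⁆∣≤d
    where
    ∣⁅x⁆∣≤d : ∣ ⁅ x ⁆ ∣ ≤ d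
    ∣⁅x⁆∣≤d = subst (_≤ d) (sym (∣⁅x⁆∣≡1 x)) 1≤d
  not-in-missing-face : ∀ k S → LeDim k (AnchoredComplex d M P) →
    MissingFace (AnchoredComplex d M P) k S → ¬ (u ∈ S × v ∈ S)
  not-in-missing-face k S (_ , (_ , ∣F∣≤1+d , _) , 1+k≤∣F∣) (∣S∣≡1+k , S∉ , proper) (u∈S , v∈S) =
    S∉ (S⊆P , ∣S∣≤1+d , anchored (neighbours-anchored nb u∈S v∈S))
    where
    S⊆P : S ⊆ P
    S⊆P {x} x∈S = proj₁ (proper ⁅ x ⁆ ⁅x⁆⊂S) (x∈⁅x⁆ x)
      where
      ⁅x⁆⊂S : ⁅ x ⁆ ⊂ S
      ⁅x⁆⊂S with x Fin.≟ u
      ... | yes refl = ⁅x⁆⊂p x∈S v∈S (neighbours-≢ nb)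
      ... | no x≢u = ⁅x⁆⊂p x∈S u∈S x≢u
    ∣S∣≤1+d : ∣ S ∣ ≤ suc d
    ∣S∣≤1+d = subst (_≤ suc d) (sym ∣S∣≡1+k) (ℕ.≤-trans 1+k≤∣F∣ ∣F∣≤1+d)

contraction⁺ : Neighbours P u v → AnchoredComplex d M (P - u) S → Contraction (AnchoredComplex d M P) u v S
contraction⁺ nb (S⊆P-u , ∣S∣≤1+d , small ∣S∣≤d) =
  inj₁ (p⊆q-x⇒x∉p S⊆P-u , p⊆q-x⇒p⊆q S⊆P-u , ∣S∣≤1+d , small ∣S∣≤d)
contraction⁺ nb (S⊆P-u , ∣S∣≤1+d , missing S≡M) =
  inj₁ (p⊆q-x⇒x∉p S⊆P-u , p⊆q-x⇒p⊆q S⊆P-u , ∣S∣≤1+d , missing S≡M)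
contraction⁺ {P = P} {u = u} {v = v} {d = d} {S = S} nb (S⊆P-u , ∣S∣≤1+d , anchored S-anchored)
  with anchored-after-removal nb S-anchored
... | inj₁ S-anchored′ = inj₁ (p⊆q-x⇒x∉p S⊆P-u , p⊆q-x⇒p⊆q S⊆P-u , ∣S∣≤1+d , anchored S-anchored′)
... | inj₂ (v∈S , S′-anchored) =
  inj₂ (S - v , u∉S-v , (S′⊆P , ∣S′∣≤1+d , anchored S′-anchored) , sym (x∈p⇒p-x∪⁅x⁆≡p S v∈S))
  where
  u∉S-v : u ∉ S - v
  u∉S-v = p⊆q-x⇒x∉p S⊆P-u ∘ x∈p-y⇒x∈p
  S′⊆P : (S - v) ∪ ⁅ u ⁆ ⊆ P
  S′⊆P x∈ with x∈p∪⁅y⁆⁻ (S - v) x∈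
  ... | inj₁ x∈S-v = p⊆q-x⇒p⊆q S⊆P-u (x∈p-y⇒x∈p x∈S-v)
  ... | inj₂ refl = neighbours-∈ˡ nb
  ∣S′∣≤1+d : ∣ (S - v) ∪ ⁅ u ⁆ ∣ ≤ suc d
  ∣S′∣≤1+d = subst (_≤ suc d) (sym (∣p-x∪⁅y⁆∣≡∣p∣ S v∈S u∉S-v)) ∣S∣≤1+d

contraction⁻ : Neighbours P u v → u ∉ M → Contraction (AnchoredComplex d M P) u v S → AnchoredComplex d M (P - u) S
contraction⁻ nb u∉M (inj₁ (u∉S , S⊆P , ∣S∣≤1+d , admitted)) =
  (λ x∈S → x∈p∧x≢y⇒x∈p-y (S⊆P x∈S) (x∈p∧y∉p⇒x≢y x∈S u∉S)) , ∣S∣≤1+d , survives admitted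
  where
  survives : Admitted _ _ _ _ → Admitted _ _ _ _
  survives (small ∣S∣≤d) = small ∣S∣≤d
  survives (anchored S-anchored) = anchored (anchored-survives-removal S-anchored u∉S)
  survives (missing S≡M) = missing S≡M
contraction⁻ {P = P} {u = u} {v = v} {M = M} {d = d} nb u∉M
  (inj₂ (F , u∉F , (F+u⊆P , ∣F+u∣≤1+d , admitted) , refl)) with v ∈? F
... | yes v∈F = subst (AnchoredComplex d M (P - u)) (sym (x∈p⇒p∪⁅x⁆≡p F v∈F))
                      (F⊆P-u , ℕ.m≤n⇒m≤1+n ∣F∣≤d , small ∣F∣≤d)
  where
  F⊆P-u : F ⊆ P - u
  F⊆P-u x∈F = x∈p∧x≢y⇒x∈p-y (F+u⊆P (x∈p⇒x∈p∪⁅y⁆ x∈F)) (x∈p∧y∉p⇒x≢y x∈F u∉F)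
  ∣F∣≤d : ∣ F ∣ ≤ d
  ∣F∣≤d = ℕ.≤-pred (subst (_≤ suc d) (x∉p⇒∣p∪⁅x⁆∣≡1+∣p∣ F u∉F) ∣F+u∣≤1+d)
... | no v∉F = F+v⊆P-u , subst (_≤ suc d) (sym ∣F+v∣≡∣F+u∣) ∣F+u∣≤1+d , contracted admitted
  where
  ∣F+v∣≡∣F+u∣ : ∣ F ∪ ⁅ v ⁆ ∣ ≡ ∣ F ∪ ⁅ u ⁆ ∣
  ∣F+v∣≡∣F+u∣ = trans (x∉p⇒∣p∪⁅x⁆∣≡1+∣p∣ F v∉F) (sym (x∉p⇒∣p∪⁅x⁆∣≡1+∣p∣ F u∉F))
  F+v⊆P-u : F ∪ ⁅ v ⁆ ⊆ P - u
  F+v⊆P-u x∈ with x∈p∪⁅y⁆⁻ F x∈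
  ... | inj₁ x∈F = x∈p∧x≢y⇒x∈p-y (F+u⊆P (x∈p⇒x∈p∪⁅y⁆ x∈F)) (x∈p∧y∉p⇒x≢y x∈F u∉F)
  ... | inj₂ refl = x∈p∧x≢y⇒x∈p-y (neighbours-∈ʳ nb) (neighbours-≢ nb ∘ sym)
  contracted : Admitted d M P (F ∪ ⁅ u ⁆) → Admitted d M (P - u) (F ∪ ⁅ v ⁆)
  contracted (small ∣F+u∣≤d) = small (subst (_≤ d) (sym ∣F+v∣≡∣F+u∣) ∣F+u∣≤d)
  contracted (anchored F+u-anchored) = anchored (anchored-contraction nb u∉F v∉F F+u-anchored)
  contracted (missing F+u≡M) = ⊥-elim (u∉M (subst (u ∈_) F+u≡M (x∈p∪⁅x⁆ F)))

contraction-to-neighbour : Neighbours P u v → u ∉ M →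
  ∀ S → AnchoredComplex d M (P - u) S ⇔ Contraction (AnchoredComplex d M P) u v S
contraction-to-neighbour nb u∉M S = mk⇔ (contraction⁺ nb) (contraction⁻ nb u∉M)

contract-to-subset : 1 ≤ d → Acc (ℕ._<_ on ∣_∣) P → Q ⊆ P → M ⊆ Q → w ∈ Q →
  Steps (AnchoredComplex d M P) (AnchoredComplex d M Q)
contract-to-subset {P = P} {Q = Q} 1≤d (acc smaller) Q⊆P M⊆Q w∈Q with ⊆-or-witness Q P
... | inj₁ P⊆Q = subst (λ P → Steps (AnchoredComplex _ _ P) (AnchoredComplex _ _ Q)) (⊆-antisym Q⊆P P⊆Q) done
... | inj₂ (u , u∈P , u∉Q) with neighbour-exists u∈P (Q⊆P w∈Q) (x∈p∧y∉p⇒x≢y w∈Q u∉Q ∘ sym)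
...   | _ , nb =
  step (contraction u _ (neighbours-admissible 1≤d nb) (contraction-to-neighbour nb (u∉Q ∘ M⊆Q)))
       (contract-to-subset 1≤d (smaller (x∈p⇒∣p-x∣<∣p∣ u∈P)) Q⊆P-u M⊆Q w∈Q)
  where
  Q⊆P-u : Q ⊆ P - u
  Q⊆P-u x∈Q = x∈p∧x≢y⇒x∈p-y (Q⊆P x∈Q) (x∈p∧y∉p⇒x≢y x∈Q u∉Q)

-- Enumerating a subset in increasing order

enum : ∀ (P : Subset n) → Fin ∣ P ∣ → Fin n
enum (inside  ∷ P) zero    = zero
enum (inside  ∷ P) (suc i) = suc (enum P i)
enum (outside ∷ P) i       = suc (enum P i)

enum-∈ : ∀ (P : Subset n) i → enum P i ∈ P
enum-∈ (inside  ∷ P) zero    = here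
enum-∈ (inside  ∷ P) (suc i) = there (enum-∈ P i)
enum-∈ (outside ∷ P) i       = there (enum-∈ P i)

enum-surjective : ∀ (P : Subset n) → x ∈ P → ∃ λ i → enum P i ≡ x
enum-surjective (inside  ∷ P) here      = zero , refl
enum-surjective (inside  ∷ P) (there x∈P) = let i , eq = enum-surjective P x∈P in suc i , cong suc eq
enum-surjective (outside ∷ P) (there x∈P) = let i , eq = enum-surjective P x∈P in i , cong suc eq

enum-mono-< : ∀ (P : Subset n) i j → i < j → enum P i < enum P j
enum-mono-< (inside  ∷ P) zero    (suc j) _         = s≤s z≤n
enum-mono-< (inside  ∷ P) (suc i) (suc j) (s≤s i<j) = s≤s (enum-mono-< P i j i<j)
enum-mono-< (outside ∷ P) i       j       i<j       = s≤s (enum-mono-< P i j i<j)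

enum-cancel-< : ∀ (P : Subset n) i j → enum P i < enum P j → i < j
enum-cancel-< P i j eᵢ<eⱼ with Fin.<-cmp i j
... | tri< i<j _ _ = i<j
... | tri≈ _ refl _ = ⊥-elim (ℕ.<-irrefl refl eᵢ<eⱼ)
... | tri> _ _ j<i = ⊥-elim (ℕ.<-asym eᵢ<eⱼ (enum-mono-< P j i j<i))

enum-injective : ∀ (P : Subset n) → Injective _≡_ _≡_ (enum P)
enum-injective P {i} {j} eᵢ≡eⱼ with Fin.<-cmp i j
... | tri< i<j _ _ = ⊥-elim (Fin.<⇒≢ (enum-mono-< P i j i<j) eᵢ≡eⱼ)
... | tri≈ _ i≡j _ = i≡j
... | tri> _ _ j<i = ⊥-elim (>⇒≢ (enum-mono-< P j i j<i) eᵢ≡eⱼ)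

embed : ∀ (P : Subset n) → Subset ∣ P ∣ → Subset n
embed []            U       = []
embed (inside  ∷ P) (b ∷ U) = b ∷ embed P U
embed (outside ∷ P) U       = outside ∷ embed P U

restrict : ∀ (P : Subset n) → Subset n → Subset ∣ P ∣
restrict []            S       = []
restrict (inside  ∷ P) (b ∷ S) = b ∷ restrict P S
restrict (outside ∷ P) (_ ∷ S) = restrict P S

∣embed∣ : ∀ (P : Subset n) U → ∣ embed P U ∣ ≡ ∣ U ∣
∣embed∣ []            []            = refl
∣embed∣ (inside  ∷ P) (inside  ∷ U) = cong suc (∣embed∣ P U)
∣embed∣ (inside  ∷ P) (outside ∷ U) = ∣embed∣ P U
∣embed∣ (outside ∷ P) U             = ∣embed∣ P U

embed-⊆ : ∀ (P : Subset n) U → embed P U ⊆ P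
embed-⊆ (inside  ∷ P) (_ ∷ U) here      = here
embed-⊆ (inside  ∷ P) (_ ∷ U) (there x∈) = there (embed-⊆ P U x∈)
embed-⊆ (outside ∷ P) U       (there x∈) = there (embed-⊆ P U x∈)

embed-restrict : ∀ (P : Subset n) S → S ⊆ P → embed P (restrict P S) ≡ S
embed-restrict []            []            _   = refl
embed-restrict (inside  ∷ P) (b ∷ S)       S⊆P = cong (b ∷_) (embed-restrict P S (drop-∷-⊆ S⊆P))
embed-restrict (outside ∷ P) (inside  ∷ S) S⊆P with () ← S⊆P here
embed-restrict (outside ∷ P) (outside ∷ S) S⊆P = cong (outside ∷_) (embed-restrict P S (drop-∷-⊆ S⊆P))

∣restrict∣ : ∀ (P : Subset n) S → S ⊆ P → ∣ restrict P S ∣ ≡ ∣ S ∣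
∣restrict∣ P S S⊆P = trans (sym (∣embed∣ P (restrict P S))) (cong ∣_∣ (embed-restrict P S S⊆P))

embed-∈⁺ : ∀ (P : Subset n) U i → i ∈ U → enum P i ∈ embed P U
embed-∈⁺ (inside  ∷ P) (_ ∷ U) zero    here       = here
embed-∈⁺ (inside  ∷ P) (_ ∷ U) (suc i) (there i∈) = there (embed-∈⁺ P U i i∈)
embed-∈⁺ (outside ∷ P) U       i       i∈         = there (embed-∈⁺ P U i i∈)

embed-∈⁻ : ∀ (P : Subset n) U → x ∈ embed P U → ∃ λ i → i ∈ U × enum P i ≡ x
embed-∈⁻ (inside  ∷ P) (_ ∷ U) here       = zero , here , refl
embed-∈⁻ (inside  ∷ P) (_ ∷ U) (there x∈) = let i , i∈ , eq = embed-∈⁻ P U x∈ in suc i , there i∈ , cong suc eq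
embed-∈⁻ (outside ∷ P) U       (there x∈) = let i , i∈ , eq = embed-∈⁻ P U x∈ in i , i∈ , cong suc eq

embed-image : ∀ (P : Subset n) U → Image (enum P) U (embed P U)
embed-image P U x = mk⇔ (embed-∈⁻ P U) λ { (i , i∈U , refl) → embed-∈⁺ P U i i∈U }

image-unique : ∀ (P : Subset n) U → Image (enum P) U S → S ≡ embed P U
image-unique P U image =
  ⊆-antisym (λ {x} x∈S → Equivalence.from (embed-image P U x) (Equivalence.to (image x) x∈S))
            (λ {x} x∈  → Equivalence.from (image x) (Equivalence.to (embed-image P U x) x∈))

-- Anchored ⊤ in terms of indices, which makes it decidable.
data PathAnchored (U : Subset m) : Set where
  first       : ∀ {i} → i ∈ U → toℕ i ≡ 0 → PathAnchored U
  last        : ∀ {i} → i ∈ U → suc (toℕ i) ≡ m → PathAnchored U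
  consecutive : ∀ {i j} → i ∈ U → j ∈ U → toℕ j ≡ suc (toℕ i) → PathAnchored U

pathAnchored? : ∀ (U : Subset m) → Dec (PathAnchored U)
pathAnchored? {m} U
  with Fin.any? (λ i → (i ∈? U) ×-dec (toℕ i ℕ.≟ 0))
     | Fin.any? (λ i → (i ∈? U) ×-dec (suc (toℕ i) ℕ.≟ m))
     | Fin.any? (λ i → Fin.any? (λ j → (i ∈? U) ×-dec (j ∈? U) ×-dec (toℕ j ℕ.≟ suc (toℕ i))))
... | yes (_ , i∈U , i≡0) | _ | _ = yes (first i∈U i≡0)
... | no _ | yes (_ , i∈U , 1+i≡m) | _ = yes (last i∈U 1+i≡m)
... | no _ | no _ | yes (_ , _ , i∈U , j∈U , j≡1+i) = yes (consecutive i∈U j∈U j≡1+i)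
... | no ∄first | no ∄last | no ∄consecutive = no λ where
  (first i∈U i≡0)             → ∄first (_ , i∈U , i≡0)
  (last i∈U 1+i≡m)            → ∄last (_ , i∈U , 1+i≡m)
  (consecutive i∈U j∈U j≡1+i) → ∄consecutive (_ , _ , i∈U , j∈U , j≡1+i)

AvoidsLast : Subset m → Set
AvoidsLast {m} V = ∀ i → i ∈ V → suc (toℕ i) ≢ m

Sparse : Subset m → Set
Sparse V = (∀ i j → i ∈ V → j ∈ V → toℕ j ≢ suc (toℕ i)) × AvoidsLast V

sparse-tail : ∀ b → Sparse (b ∷ V) → Sparse V
sparse-tail _ (apart , avoids-last) =
  (λ i j i∈V j∈V j≡1+i → apart (suc i) (suc j) (there i∈V) (there j∈V) (cong suc j≡1+i)) ,
  (λ i i∈V 1+i≡m → avoids-last (suc i) (there i∈V) (cong suc 1+i≡m))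

¬pathAnchored⇒sparse : ¬ PathAnchored U → Sparse U
¬pathAnchored⇒sparse ¬anchored =
  (λ i j i∈U j∈U j≡1+i → ¬anchored (consecutive i∈U j∈U j≡1+i)) , (λ i i∈U 1+i≡m → ¬anchored (last i∈U 1+i≡m))

sparse-bound : ∀ (V : Subset m) → Sparse V → ∣ V ∣ + ∣ V ∣ ≤ m
sparse-bound []                      _ = z≤n
sparse-bound (outside ∷ V)           sparse = ℕ.m≤n⇒m≤1+n (sparse-bound V (sparse-tail _ sparse))
sparse-bound (inside ∷ [])           (_ , avoids-last) = ⊥-elim (avoids-last zero here refl)
sparse-bound (inside ∷ inside ∷ V)   (apart , _) = ⊥-elim (apart zero (suc zero) here (there here) refl)
sparse-bound {suc (suc m)} (inside ∷ outside ∷ V) sparse =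
  s≤s (subst (_≤ suc m) (sym (ℕ.+-suc ∣ V ∣ ∣ V ∣))
             (s≤s (sparse-bound V (sparse-tail _ (sparse-tail _ sparse)))))

double : ℕ → ℕ
double zero    = zero
double (suc k) = suc (suc (double k))

double≡k+k : ∀ k → double k ≡ k + k
double≡k+k zero    = refl
double≡k+k (suc k) = cong suc (trans (cong suc (double≡k+k k)) (sym (ℕ.+-suc k k)))

alternating : ∀ k → Subset (double k)
alternating zero    = []
alternating (suc k) = inside ∷ outside ∷ alternating k

sparse⇒alternating : ∀ k (V : Subset (double (suc k))) → Sparse V → ∣ V ∣ ≡ suc k → V ≡ alternating (suc k)
sparse⇒alternating k (outside ∷ V) sparse ∣V∣≡1+k =
  ⊥-elim (ℕ.1+n≰n (subst (_≤ suc (double k)) 2∣V∣≡ (sparse-bound V (sparse-tail _ sparse))))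
  where
  2∣V∣≡ : ∣ V ∣ + ∣ V ∣ ≡ suc (suc (double k))
  2∣V∣≡ = trans (cong (λ c → c + c) ∣V∣≡1+k) (sym (double≡k+k (suc k)))
sparse⇒alternating k (inside ∷ inside ∷ V) (apart , _) _ = ⊥-elim (apart zero (suc zero) here (there here) refl)
sparse⇒alternating zero (inside ∷ outside ∷ []) _ _ = refl
sparse⇒alternating (suc k) (inside ∷ outside ∷ V) sparse ∣V∣≡1+k =
  cong (λ W → inside ∷ outside ∷ W)
       (sparse⇒alternating k V (sparse-tail _ (sparse-tail _ sparse)) (ℕ.suc-injective ∣V∣≡1+k))

¬pathAnchored⇒alternating : ∀ k (U : Subset (suc (double (suc k)))) → ¬ PathAnchored U → ∣ U ∣ ≡ suc k →
  U ≡ outside ∷ alternating (suc k)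
¬pathAnchored⇒alternating k (inside ∷ V) ¬anchored _ = ⊥-elim (¬anchored (first here refl))
¬pathAnchored⇒alternating k (outside ∷ V) ¬anchored ∣V∣≡1+k =
  cong (outside ∷_) (sparse⇒alternating k V (sparse-tail _ (¬pathAnchored⇒sparse ¬anchored)) ∣V∣≡1+k)

gap⇒toℕ-suc : ∀ {a b : Fin n} → a < b → (∀ c → a < c → ¬ c < b) → toℕ b ≡ suc (toℕ a)
gap⇒toℕ-suc {n} {a} {b} a<b gap with ℕ.m≤n⇒m<n∨m≡n a<b
... | inj₂ 1+a≡b = sym 1+a≡b
... | inj₁ 1+a<b = ⊥-elim (gap c (ℕ.≤-reflexive (sym c≡1+a)) (subst (ℕ._< toℕ b) (sym c≡1+a) 1+a<b))
  where
  c : Fin n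
  c = Fin.fromℕ< (ℕ.<-trans 1+a<b (Fin.toℕ<n b))
  c≡1+a : toℕ c ≡ suc (toℕ a)
  c≡1+a = Fin.toℕ-fromℕ< (ℕ.<-trans 1+a<b (Fin.toℕ<n b))

least-⊤ : Least ⊤ a → toℕ a ≡ 0
least-⊤ {a = zero}  _             = refl
least-⊤ {a = suc a} (_ , minimal) = ⊥-elim (minimal zero ∈⊤ (s≤s z≤n))

greatest-⊤ : Greatest {n} ⊤ a → suc (toℕ a) ≡ n
greatest-⊤ {a = a} (_ , maximal) with ℕ.m≤n⇒m<n∨m≡n (Fin.toℕ<n a)
... | inj₂ 1+a≡n = 1+a≡n
... | inj₁ 1+a<n = ⊥-elim (maximal (Fin.fromℕ< 1+a<n) ∈⊤ (ℕ.≤-reflexive (sym (Fin.toℕ-fromℕ< 1+a<n))))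

anchored-⊤⇒pathAnchored : Anchored ⊤ S → PathAnchored S
anchored-⊤⇒pathAnchored (consecutive a∈S b∈S (_ , _ , a<b , gap)) =
  consecutive a∈S b∈S (gap⇒toℕ-suc a<b (λ c → gap c ∈⊤))
anchored-⊤⇒pathAnchored (least a∈S a-least)                       = first a∈S (least-⊤ a-least)
anchored-⊤⇒pathAnchored (greatest a∈S a-greatest)                 = last a∈S (greatest-⊤ a-greatest)

pathAnchored⇒anchored-⊤ : PathAnchored S → Anchored ⊤ S
pathAnchored⇒anchored-⊤ (first {i} i∈S i≡0) =
  least i∈S (∈⊤ , λ c _ c<i → ℕ.n≮0 (subst (toℕ c ℕ.<_) i≡0 c<i))
pathAnchored⇒anchored-⊤ (last {i} i∈S 1+i≡n) =
  greatest i∈S (∈⊤ , λ c _ i<c → ℕ.<⇒≱ (Fin.toℕ<n c) (subst (_≤ toℕ c) 1+i≡n i<c))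
pathAnchored⇒anchored-⊤ (consecutive {i} {j} i∈S j∈S j≡1+i) =
  consecutive i∈S j∈S (∈⊤ , ∈⊤ , ℕ.≤-reflexive (sym j≡1+i) ,
                       λ c _ i<c c<j → ℕ.<⇒≱ c<j (subst (_≤ toℕ c) (sym j≡1+i) i<c))

anchored-⊤⇒anchored-embed : ∀ (P : Subset n) U → Anchored ⊤ U → Anchored P (embed P U)
anchored-⊤⇒anchored-embed P U (consecutive {i} {j} i∈U j∈U (_ , _ , i<j , gap)) =
  consecutive (embed-∈⁺ P U i i∈U) (embed-∈⁺ P U j j∈U)
    (enum-∈ P i , enum-∈ P j , enum-mono-< P i j i<j , λ c c∈P → between (enum-surjective P c∈P))
  where
  between : ∀ {c} → ∃ (λ k → enum P k ≡ c) → enum P i < c → ¬ c < enum P j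
  between (k , refl) eᵢ<eₖ eₖ<eⱼ = gap k ∈⊤ (enum-cancel-< P i k eᵢ<eₖ) (enum-cancel-< P k j eₖ<eⱼ)
anchored-⊤⇒anchored-embed P U (least {i} i∈U (_ , minimal)) =
  least (embed-∈⁺ P U i i∈U) (enum-∈ P i , λ c c∈P → below (enum-surjective P c∈P))
  where
  below : ∀ {c} → ∃ (λ k → enum P k ≡ c) → ¬ c < enum P i
  below (k , refl) eₖ<eᵢ = minimal k ∈⊤ (enum-cancel-< P k i eₖ<eᵢ)
anchored-⊤⇒anchored-embed P U (greatest {i} i∈U (_ , maximal)) =
  greatest (embed-∈⁺ P U i i∈U) (enum-∈ P i , λ c c∈P → above (enum-surjective P c∈P))
  where
  above : ∀ {c} → ∃ (λ k → enum P k ≡ c) → ¬ enum P i < c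
  above (k , refl) eᵢ<eₖ = maximal k ∈⊤ (enum-cancel-< P i k eᵢ<eₖ)

¬pathAnchored-unique : m ≡ suc (double (suc k)) → ∀ (U V : Subset m) → ¬ PathAnchored U → ¬ PathAnchored V →
  ∣ U ∣ ≡ suc k → ∣ V ∣ ≡ suc k → U ≡ V
¬pathAnchored-unique {k = k} refl U V ¬U-anchored ¬V-anchored ∣U∣≡1+k ∣V∣≡1+k =
  trans (¬pathAnchored⇒alternating k U ¬U-anchored ∣U∣≡1+k)
        (sym (¬pathAnchored⇒alternating k V ¬V-anchored ∣V∣≡1+k))

anchoredComplex≅skeleton : ∣ P ∣ ≡ suc (double (suc d)) → M ⊆ P → ∣ M ∣ ≡ suc d → ¬ Anchored P M →
  Isomorphic (AnchoredComplex d M P) (SimplexSkeleton ∣ P ∣ d)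
anchoredComplex≅skeleton {P = P} {d = d} {M = M} ∣P∣≡ M⊆P ∣M∣≡1+d ¬M-anchored =
  enum P , enum-injective P , λ S → mk⇔ (to S) (from S)
  where
  to : ∀ S → AnchoredComplex d M P S → ∃ λ U → SimplexSkeleton ∣ P ∣ d U × Image (enum P) U S
  to S (S⊆P , ∣S∣≤1+d , _) =
    restrict P S , subst (_≤ suc d) (sym (∣restrict∣ P S S⊆P)) ∣S∣≤1+d ,
    subst (Image (enum P) (restrict P S)) (embed-restrict P S S⊆P) (embed-image P (restrict P S))

  ¬M′-anchored : ¬ PathAnchored (restrict P M)
  ¬M′-anchored M′-anchored = ¬M-anchored (subst (Anchored P) (embed-restrict P M M⊆P)
    (anchored-⊤⇒anchored-embed P _ (pathAnchored⇒anchored-⊤ M′-anchored)))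

  admitted : ∀ U → ∣ U ∣ ≤ suc d → Admitted d M P (embed P U)
  admitted U ∣U∣≤1+d with ∣ U ∣ ℕ.≤? d | pathAnchored? U
  ... | yes ∣U∣≤d | _ = small (subst (_≤ d) (sym (∣embed∣ P U)) ∣U∣≤d)
  ... | no _ | yes U-anchored =
    anchored (anchored-⊤⇒anchored-embed P U (pathAnchored⇒anchored-⊤ U-anchored))
  ... | no ∣U∣≰d | no ¬U-anchored = missing (trans (cong (embed P) U≡M′) (embed-restrict P M M⊆P))
    where
    U≡M′ : U ≡ restrict P M
    U≡M′ = ¬pathAnchored-unique ∣P∣≡ U (restrict P M) ¬U-anchored ¬M′-anchored
             (ℕ.≤-antisym ∣U∣≤1+d (ℕ.≰⇒> ∣U∣≰d)) (trans (∣restrict∣ P M M⊆P) ∣M∣≡1+d)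

  from : ∀ S → (∃ λ U → SimplexSkeleton ∣ P ∣ d U × Image (enum P) U S) → AnchoredComplex d M P S
  from S (U , ∣U∣≤1+d , image) = subst (AnchoredComplex d M P) (sym (image-unique P U image))
    (embed-⊆ P U , subst (_≤ suc d) (sym (∣embed∣ P U)) ∣U∣≤1+d , admitted U ∣U∣≤1+d)

shift : Bool → Subset m → Subset m
shift c []      = []
shift c (b ∷ V) = c ∷ shift b V

shift-∈⁺ : ∀ c (V : Subset m) {x y} → y ∈ V → toℕ x ≡ suc (toℕ y) → x ∈ shift c V
shift-∈⁺ c (inside ∷ _ ∷ V) {suc zero} {zero}  here      _       = there here
shift-∈⁺ c (b ∷ V)          {suc x}    {suc y} (there y∈) x≡1+y = there (shift-∈⁺ b V y∈ (ℕ.suc-injective x≡1+y))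

shift-∈⁻ : ∀ c (V : Subset m) {x} → x ∈ shift c V →
  (toℕ x ≡ 0 × c ≡ inside) ⊎ (∃ λ y → y ∈ V × toℕ x ≡ suc (toℕ y))
shift-∈⁻ inside (_ ∷ V) {zero}  here       = inj₁ (refl , refl)
shift-∈⁻ c      (b ∷ V) {suc x} (there x∈) with shift-∈⁻ b V x∈
... | inj₁ (x≡0 , refl)       = inj₂ (zero , here , cong suc x≡0)
... | inj₂ (y , y∈V , x≡1+y) = inj₂ (suc y , there y∈V , cong suc x≡1+y)

∣shift∣ : ∀ c (V : Subset m) → AvoidsLast (c ∷ V) → ∣ shift c V ∣ ≡ ∣ c ∷ V ∣
∣shift∣ inside  []      avoids-last = ⊥-elim (avoids-last zero here refl)
∣shift∣ outside []      _           = refl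
∣shift∣ c       (b ∷ V) avoids-last = cons c (∣shift∣ b V λ i i∈ → avoids-last (suc i) (there i∈) ∘ cong suc)
  where
  cons : ∀ c → ∣ shift b V ∣ ≡ ∣ b ∷ V ∣ → ∣ c ∷ shift b V ∣ ≡ ∣ c ∷ b ∷ V ∣
  cons inside  eq = cong suc eq
  cons outside eq = eq

-- frame M = {0} ∪ M ∪ (M + 1), the set F of the proof idea (vertices counted from 0).
frame : Subset (suc m) → Subset (suc m)
frame M = shift outside M ∪ (M ∪ ⁅ zero ⁆)

M⊆frame : ∀ (M : Subset (suc m)) → M ⊆ frame M
M⊆frame M x∈M = x∈p∪q⁺ (inj₂ (x∈p⇒x∈p∪⁅y⁆ {y = zero} x∈M))

zero∈frame : ∀ (M : Subset (suc m)) → zero ∈ frame M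
zero∈frame M = x∈p∪q⁺ (inj₂ (x∈p∪⁅x⁆ M))

module _ {M : Subset (suc m)} (¬M-anchored : ¬ PathAnchored M) where

  next∈frame : ∀ {a} → a ∈ M → ∃ λ c → toℕ c ≡ suc (toℕ a) × c ∈ frame M
  next∈frame {a} a∈M = c , c≡1+a , x∈p∪q⁺ (inj₁ (shift-∈⁺ outside M a∈M c≡1+a))
    where
    1+a<1+m : suc (toℕ a) ℕ.< suc m
    1+a<1+m = ℕ.≤∧≢⇒< (Fin.toℕ<n a) (¬M-anchored ∘ last a∈M)
    c : Fin (suc m)
    c = Fin.fromℕ< 1+a<1+m
    c≡1+a : toℕ c ≡ suc (toℕ a)
    c≡1+a = Fin.toℕ-fromℕ< 1+a<1+m

  ¬anchored-frame : ¬ Anchored (frame M) M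
  ¬anchored-frame (consecutive {a} {b} a∈M b∈M (_ , _ , a<b , gap)) with next∈frame a∈M
  ... | c , c≡1+a , c∈frame =
    gap c c∈frame (ℕ.≤-reflexive (sym c≡1+a)) (ℕ.≤∧≢⇒< (subst (_≤ toℕ b) (sym c≡1+a) a<b) c≢b)
    where
    c≢b : toℕ c ≢ toℕ b
    c≢b c≡b = ¬M-anchored (consecutive a∈M b∈M (trans (sym c≡b) c≡1+a))
  ¬anchored-frame (least a∈M (_ , minimal)) =
    minimal zero (zero∈frame M) (ℕ.n≢0⇒n>0 (¬M-anchored ∘ first a∈M))
  ¬anchored-frame (greatest a∈M (_ , maximal)) =
    let c , c≡1+a , c∈frame = next∈frame a∈M in maximal c c∈frame (ℕ.≤-reflexive (sym c≡1+a))

  ∣frame∣ : ∣ frame M ∣ ≡ suc (double ∣ M ∣)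
  ∣frame∣ = begin
    ∣ frame M ∣                                       ≡⟨ ∣p∪q∣≡∣p∣+∣q∣ (shift outside M) _ disjoint ⟩
    ∣ shift outside M ∣ + ∣ M ∪ ⁅ zero ⁆ ∣             ≡⟨ cong₂ _+_ (∣shift∣ outside M avoids-last)
                                                                   (x∉p⇒∣p∪⁅x⁆∣≡1+∣p∣ M 0∉M) ⟩
    ∣ M ∣ + suc ∣ M ∣                                  ≡⟨ ℕ.+-suc ∣ M ∣ ∣ M ∣ ⟩
    suc (∣ M ∣ + ∣ M ∣)                                ≡⟨ cong suc (double≡k+k ∣ M ∣) ⟨
    suc (double ∣ M ∣)                                 ∎
    where
    disjoint : ∀ {x} → x ∈ shift outside M → x ∉ M ∪ ⁅ zero ⁆
    disjoint x∈ x∈′ with shift-∈⁻ outside M x∈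
    ... | inj₁ (_ , ())
    ... | inj₂ (y , y∈M , x≡1+y) with x∈p∪⁅y⁆⁻ {y = zero} M x∈′
    ...   | inj₁ x∈M = ¬M-anchored (consecutive y∈M x∈M x≡1+y)
    ...   | inj₂ refl = ℕ.0≢1+n x≡1+y
    0∉M : zero ∉ M
    0∉M 0∈M = ¬M-anchored (first 0∈M refl)
    avoids-last : AvoidsLast (outside ∷ M)
    avoids-last (suc i) (there i∈M) 1+i≡m = ¬M-anchored (last i∈M (ℕ.suc-injective 1+i≡m))

-- Faces of the cyclic polytope

degree-bound : ∀ {b e r} → b ≤ e + e → e + r ≤ suc d → b + (r + r) ≤ suc (2 * d + 1)
degree-bound {d = d} {b} {e} {r} b≤2e e+r≤1+d =
  ℕ.≤-trans (ℕ.+-monoˡ-≤ (r + r) b≤2e)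
            (subst₂ _≤_ (sym (regroup e r)) (twice-suc d) (ℕ.+-mono-≤ e+r≤1+d e+r≤1+d))
  where
  regroup : ∀ e r → (e + e) + (r + r) ≡ (e + r) + (e + r)
  regroup = ℕ-Solver.solve-∀
  twice-suc : ∀ d → suc d + suc d ≡ suc (2 * d + 1)
  twice-suc = ℕ-Solver.solve-∀

module CyclicPolytopeFaces where

  open import Data.Integer.Base using (+_)

  evalPoly : List ℤ → ℤ → ℤ
  evalPoly []      t = 0ℤ
  evalPoly (a ∷ p) t = a ℤ.+ t ℤ.* evalPoly p t

  evalPoly-constant : ∀ c t → evalPoly (c ∷ []) t ≡ c
  evalPoly-constant c t = trans (cong (λ e → c ℤ.+ e) (ℤ.*-zeroʳ t)) (ℤ.+-identityʳ c)

  addConstant : ℤ → List ℤ → List ℤ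
  addConstant a []      = a ∷ []
  addConstant a (b ∷ p) = a ℤ.+ b ∷ p

  mulRoot : ℤ → List ℤ → List ℤ
  mulRoot r []      = []
  mulRoot r (a ∷ p) = ℤ.- (r ℤ.* a) ∷ addConstant a (mulRoot r p)

  evalPoly-addConstant : ∀ a p t → evalPoly (addConstant a p) t ≡ a ℤ.+ evalPoly p t
  evalPoly-addConstant a []      t = cong (λ e → a ℤ.+ e) (ℤ.*-zeroʳ t)
  evalPoly-addConstant a (b ∷ p) t = ℤ.+-assoc a b (t ℤ.* evalPoly p t)

  evalPoly-mulRoot : ∀ r p t → evalPoly (mulRoot r p) t ≡ (t ℤ.- r) ℤ.* evalPoly p t
  evalPoly-mulRoot r []      t = sym (ℤ.*-zeroʳ (t ℤ.- r))
  evalPoly-mulRoot r (a ∷ p) t = begin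
    ℤ.- (r ℤ.* a) ℤ.+ t ℤ.* evalPoly (addConstant a (mulRoot r p)) t
      ≡⟨ cong (λ e → ℤ.- (r ℤ.* a) ℤ.+ t ℤ.* e)
              (trans (evalPoly-addConstant a (mulRoot r p) t) (cong (λ e → a ℤ.+ e) (evalPoly-mulRoot r p t))) ⟩
    ℤ.- (r ℤ.* a) ℤ.+ t ℤ.* (a ℤ.+ (t ℤ.- r) ℤ.* evalPoly p t)
      ≡⟨ expand r a t (evalPoly p t) ⟩
    (t ℤ.- r) ℤ.* (a ℤ.+ t ℤ.* evalPoly p t) ∎
    where
    expand : ∀ r a t e → ℤ.- (r ℤ.* a) ℤ.+ t ℤ.* (a ℤ.+ (t ℤ.- r) ℤ.* e) ≡ (t ℤ.- r) ℤ.* (a ℤ.+ t ℤ.* e)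
    expand = solve-∀

  length-mulRoot : ∀ r p → length (mulRoot r p) ≤ suc (length p)
  length-mulRoot r []      = z≤n
  length-mulRoot r (a ∷ p) = s≤s (length-addConstant (mulRoot r p) (length-mulRoot r p))
    where
    length-addConstant : ∀ q → length q ≤ suc (length p) → length (addConstant a q) ≤ suc (length p)
    length-addConstant []      _ = s≤s z≤n
    length-addConstant (_ ∷ q) h = h

  IsPositive : ℤ → Set
  IsPositive x = ∃ λ k → x ≡ +[1+ k ]

  *-isPositive : ∀ {x y} → IsPositive x → IsPositive y → IsPositive (x ℤ.* y)
  *-isPositive (_ , refl) (_ , refl) = _ , refl

  square-isPositive : ∀ x → x ≢ 0ℤ → IsPositive (x ℤ.* x)
  square-isPositive (+ zero)  x≢0 = ⊥-elim (x≢0 refl)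
  square-isPositive +[1+ k ]  _   = _ , refl
  square-isPositive -[1+ k ]  _   = _ , refl

  positive-difference : ∀ {m n} → m ℕ.< n → IsPositive (+ n ℤ.- + m)
  positive-difference {m} {n} m<n =
    subst IsPositive (sym (trans (ℤ.m-n≡m⊖n n m) (ℤ.⊖-≥ (ℕ.<⇒≤ m<n)))) (positive (ℕ.m<n⇒0<n∸m m<n))
    where
    positive : ∀ {k} → 0 ℕ.< k → IsPositive (+ k)
    positive {suc k} _ = k , refl

  parameter : Fin n → ℤ
  parameter i = + suc (toℕ i)

  parameter-injective : parameter x ≡ parameter y → x ≡ y
  parameter-injective eq = Fin.toℕ-injective (ℕ.suc-injective (ℤ.+-injective eq))

  -- p · ∏_{i ∈ R} (X - (k + 1 + i))²; the offset k is the position of R inside the full vector.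
  squaresFrom : ℕ → Subset m → List ℤ → List ℤ
  squaresFrom k []            p = p
  squaresFrom k (inside ∷ R)  p = squaresFrom (suc k) R (mulRoot (+ suc k) (mulRoot (+ suc k) p))
  squaresFrom k (outside ∷ R) p = squaresFrom (suc k) R p

  squaresValue : ℕ → Subset m → ℤ → ℤ
  squaresValue k []            t = 1ℤ
  squaresValue k (inside ∷ R)  t = ((t ℤ.- + suc k) ℤ.* (t ℤ.- + suc k)) ℤ.* squaresValue (suc k) R t
  squaresValue k (outside ∷ R) t = squaresValue (suc k) R t

  evalPoly-squaresFrom : ∀ k (R : Subset m) p t →
    evalPoly (squaresFrom k R p) t ≡ evalPoly p t ℤ.* squaresValue k R t
  evalPoly-squaresFrom k []            p t = sym (ℤ.*-identityʳ (evalPoly p t))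
  evalPoly-squaresFrom k (outside ∷ R) p t = evalPoly-squaresFrom (suc k) R p t
  evalPoly-squaresFrom k (inside ∷ R)  p t = begin
    evalPoly (squaresFrom (suc k) R (mulRoot r (mulRoot r p))) t
      ≡⟨ evalPoly-squaresFrom (suc k) R _ t ⟩
    evalPoly (mulRoot r (mulRoot r p)) t ℤ.* squaresValue (suc k) R t
      ≡⟨ cong (ℤ._* squaresValue (suc k) R t)
              (trans (evalPoly-mulRoot r (mulRoot r p) t) (cong ((t ℤ.- r) ℤ.*_) (evalPoly-mulRoot r p t))) ⟩
    ((t ℤ.- r) ℤ.* ((t ℤ.- r) ℤ.* evalPoly p t)) ℤ.* squaresValue (suc k) R t
      ≡⟨ regroup (t ℤ.- r) (evalPoly p t) (squaresValue (suc k) R t) ⟩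
    evalPoly p t ℤ.* (((t ℤ.- r) ℤ.* (t ℤ.- r)) ℤ.* squaresValue (suc k) R t) ∎
    where
    r : ℤ
    r = + suc k
    regroup : ∀ x e s → (x ℤ.* (x ℤ.* e)) ℤ.* s ≡ e ℤ.* ((x ℤ.* x) ℤ.* s)
    regroup = solve-∀

  length-squaresFrom : ∀ k (R : Subset m) p → length (squaresFrom k R p) ≤ length p ℕ.+ (∣ R ∣ ℕ.+ ∣ R ∣)
  length-squaresFrom k []            p = ℕ.m≤m+n (length p) 0
  length-squaresFrom k (outside ∷ R) p = length-squaresFrom (suc k) R p
  length-squaresFrom k (inside ∷ R)  p =
    ℕ.≤-trans (length-squaresFrom (suc k) R _)
      (ℕ.≤-trans (ℕ.+-monoˡ-≤ _ (ℕ.≤-trans (length-mulRoot r (mulRoot r p)) (s≤s (length-mulRoot r p))))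
                 (ℕ.≤-reflexive (rearrange (length p) ∣ R ∣)))
    where
    r : ℤ
    r = + suc k
    rearrange : ∀ a c → suc (suc a) ℕ.+ (c ℕ.+ c) ≡ a ℕ.+ (suc c ℕ.+ suc c)
    rearrange = ℕ-Solver.solve-∀

  offset-suc : ∀ k i → + suc (k ℕ.+ suc i) ≡ + suc (suc k ℕ.+ i)
  offset-suc k i = cong (λ j → + suc j) (ℕ.+-suc k i)

  squaresValue-root : ∀ k (R : Subset m) {i t} → i ∈ R → t ≡ + suc (k ℕ.+ toℕ i) → squaresValue k R t ≡ 0ℤ
  squaresValue-root k (inside ∷ R) here refl =
    cong (λ x → (x ℤ.* x) ℤ.* squaresValue (suc k) R (+ suc (k ℕ.+ 0)))
         (trans (cong (λ j → + suc j ℤ.- + suc k) (ℕ.+-identityʳ k)) (ℤ.+-inverseʳ (+ suc k)))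
  squaresValue-root k (inside ∷ R) {suc i} {t} (there i∈R) t≡ =
    trans (cong ((t ℤ.- + suc k) ℤ.* (t ℤ.- + suc k) ℤ.*_)
                (squaresValue-root (suc k) R i∈R (trans t≡ (offset-suc k (toℕ i)))))
          (ℤ.*-zeroʳ ((t ℤ.- + suc k) ℤ.* (t ℤ.- + suc k)))
  squaresValue-root k (outside ∷ R) {suc i} (there i∈R) t≡ =
    squaresValue-root (suc k) R i∈R (trans t≡ (offset-suc k (toℕ i)))

  ∉roots-tail : ∀ {k b} {R : Subset m} {t} → (∀ i → i ∈ b ∷ R → t ≢ + suc (k ℕ.+ toℕ i)) →
    ∀ i → i ∈ R → t ≢ + suc (suc k ℕ.+ toℕ i)
  ∉roots-tail {k = k} ∉roots i i∈R eq = ∉roots (suc i) (there i∈R) (trans eq (sym (offset-suc k (toℕ i))))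

  squaresValue-positive : ∀ k (R : Subset m) t → (∀ i → i ∈ R → t ≢ + suc (k ℕ.+ toℕ i)) →
    IsPositive (squaresValue k R t)
  squaresValue-positive k []            t _       = 0 , refl
  squaresValue-positive k (inside ∷ R)  t ∉roots =
    *-isPositive (square-isPositive (t ℤ.- + suc k) t≢k) (squaresValue-positive (suc k) R t (∉roots-tail ∉roots))
    where
    t≢k : t ℤ.- + suc k ≢ 0ℤ
    t≢k eq = ∉roots zero here (trans (ℤ.i-j≡0⇒i≡j t _ eq) (cong (λ j → + suc j) (sym (ℕ.+-identityʳ k))))
  squaresValue-positive k (outside ∷ R) t ∉roots = squaresValue-positive (suc k) R t (∉roots-tail ∉roots)

  ι : ℤ → ℚ
  ι x = x / 1

  ι≡mkℚ : ∀ x → ι x ≡ mkℚ x 0 (λ {d} d∣ → ∣1⇒≡1 (proj₂ d∣))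
  ι≡mkℚ x = ℚ.↥p/↧p≡p (mkℚ x 0 (λ {d} d∣ → ∣1⇒≡1 (proj₂ d∣)))

  ι-+ : ∀ x y → ι x ℚ.+ ι y ≡ ι (x ℤ.+ y)
  ι-+ x y = trans (cong₂ ℚ._+_ (ι≡mkℚ x) (ι≡mkℚ y))
                  (cong (_/ 1) (cong₂ ℤ._+_ (ℤ.*-identityʳ x) (ℤ.*-identityʳ y)))

  ι-* : ∀ x y → ι x ℚ.* ι y ≡ ι (x ℤ.* y)
  ι-* x y = cong₂ ℚ._*_ (ι≡mkℚ x) (ι≡mkℚ y)

  ι-< : ∀ {x y} → x ℤ.< y → ι x ℚ.< ι y
  ι-< {x} {y} x<y = subst₂ ℚ._<_ (sym (ι≡mkℚ x)) (sym (ι≡mkℚ y))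
    (ℚ.*<* (subst₂ ℤ._<_ (sym (ℤ.*-identityʳ x)) (sym (ℤ.*-identityʳ y)) x<y))

  sumℤ : ∀ {D} → (Fin D → ℤ) → ℤ
  sumℤ {zero}  f = 0ℤ
  sumℤ {suc D} f = f zero ℤ.+ sumℤ (f ∘ suc)

  sumℤ-cong : ∀ {D} {f g : Fin D → ℤ} → (∀ j → f j ≡ g j) → sumℤ f ≡ sumℤ g
  sumℤ-cong {zero}  f≗g = refl
  sumℤ-cong {suc D} f≗g = cong₂ ℤ._+_ (f≗g zero) (sumℤ-cong (f≗g ∘ suc))

  sumFin-cong : ∀ {D} {f g : Fin D → ℚ} → (∀ j → f j ≡ g j) → sumFin f ≡ sumFin g
  sumFin-cong {zero}  f≗g = refl
  sumFin-cong {suc D} f≗g = cong₂ ℚ._+_ (f≗g zero) (sumFin-cong (f≗g ∘ suc))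

  sumFin-ι : ∀ {D} (f : Fin D → ℤ) → sumFin (ι ∘ f) ≡ ι (sumℤ f)
  sumFin-ι {zero}  f = refl
  sumFin-ι {suc D} f = trans (cong (λ s → ι (f zero) ℚ.+ s) (sumFin-ι (f ∘ suc))) (ι-+ (f zero) (sumℤ (f ∘ suc)))

  coeff : List ℤ → ℕ → ℤ
  coeff []      j       = 0ℤ
  coeff (a ∷ p) zero    = a
  coeff (a ∷ p) (suc j) = coeff p j

  coeff-suc : ∀ p j → coeff p (suc j) ≡ coeff (drop 1 p) j
  coeff-suc []      j = refl
  coeff-suc (a ∷ p) j = refl

  evalPoly-drop : ∀ p t → evalPoly p t ≡ coeff p 0 ℤ.+ t ℤ.* evalPoly (drop 1 p) t
  evalPoly-drop []      t = sym (trans (ℤ.+-identityˡ (t ℤ.* 0ℤ)) (ℤ.*-zeroʳ t))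
  evalPoly-drop (a ∷ p) t = refl

  length-drop : ∀ {D} (p : List ℤ) → length p ≤ suc D → length (drop 1 p) ≤ D
  length-drop []      _             = z≤n
  length-drop (a ∷ p) (s≤s len≤D) = len≤D

  momentSum : ∀ D p e T → length p ≤ D →
    sumℤ {D} (λ j → ℤ.- coeff p (toℕ j) ℤ.* + (T ℕ.^ (e ℕ.+ toℕ j))) ≡ ℤ.- (+ (T ℕ.^ e) ℤ.* evalPoly p (+ T))
  momentSum zero    []  e T _   = cong ℤ.-_ (sym (ℤ.*-zeroʳ (+ (T ℕ.^ e))))
  momentSum (suc D) p   e T len = begin
    f₀ ℤ.+ sumℤ {D} (λ j → ℤ.- coeff p (suc (toℕ j)) ℤ.* + (T ℕ.^ (e ℕ.+ suc (toℕ j))))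
      ≡⟨ cong (λ s → f₀ ℤ.+ s) (sumℤ-cong {D} λ j →
           cong₂ (λ c x → ℤ.- c ℤ.* + (T ℕ.^ x)) (coeff-suc p (toℕ j)) (ℕ.+-suc e (toℕ j))) ⟩
    f₀ ℤ.+ sumℤ {D} (λ j → ℤ.- coeff (drop 1 p) (toℕ j) ℤ.* + (T ℕ.^ (suc e ℕ.+ toℕ j)))
      ≡⟨ cong (λ s → f₀ ℤ.+ s) (momentSum D (drop 1 p) (suc e) T (length-drop {D} p len)) ⟩
    f₀ ℤ.+ ℤ.- (+ (T ℕ.* T ℕ.^ e) ℤ.* E)
      ≡⟨ cong₂ (λ x y → ℤ.- coeff p 0 ℤ.* + (T ℕ.^ x) ℤ.+ ℤ.- (y ℤ.* E)) (ℕ.+-identityʳ e) (ℤ.pos-* T (T ℕ.^ e)) ⟩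
    ℤ.- coeff p 0 ℤ.* X ℤ.+ ℤ.- ((+ T ℤ.* X) ℤ.* E)
      ≡⟨ factor (coeff p 0) X (+ T) E ⟩
    ℤ.- (X ℤ.* (coeff p 0 ℤ.+ + T ℤ.* E))
      ≡⟨ cong (λ v → ℤ.- (X ℤ.* v)) (evalPoly-drop p (+ T)) ⟨
    ℤ.- (X ℤ.* evalPoly p (+ T)) ∎
    where
    f₀ X E : ℤ
    f₀ = ℤ.- coeff p 0 ℤ.* + (T ℕ.^ (e ℕ.+ 0))
    X = + (T ℕ.^ e)
    E = evalPoly (drop 1 p) (+ T)
    factor : ∀ a X t E → ℤ.- a ℤ.* X ℤ.+ ℤ.- ((t ℤ.* X) ℤ.* E) ≡ ℤ.- (X ℤ.* (a ℤ.+ t ℤ.* E))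
    factor = solve-∀

  -- From q(t) = q₀ + t·q'(t) ≥ 0 with equality exactly on S: the functional -q' on the moment
  -- curve is maximised, with value q₀, exactly at the vertices of S.
  face-of-polynomial : ∀ D n (S : Subset n) q → length q ≤ suc D →
    (∀ i → i ∈ S → evalPoly q (parameter i) ≡ 0ℤ) → (∀ i → i ∉ S → IsPositive (evalPoly q (parameter i))) →
    IsFace D n S
  face-of-polynomial D n S q len vanishes positive = c , ι (coeff q 0) , λ i → on-face i , off-face i
    where
    c : Fin D → ℚ
    c j = ι (ℤ.- coeff (drop 1 q) (toℕ j))

    eval≡ : ∀ i → eval c i ≡ ι (coeff q 0 ℤ.- evalPoly q (parameter i))
    eval≡ i = begin
      eval c i
        ≡⟨ sumFin-cong {D} (λ j → ι-* (ℤ.- coeff (drop 1 q) (toℕ j)) (+ (Tᵢ ℕ.^ suc (toℕ j)))) ⟩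
      sumFin {D} (λ j → ι (ℤ.- coeff (drop 1 q) (toℕ j) ℤ.* + (Tᵢ ℕ.^ (1 ℕ.+ toℕ j))))
        ≡⟨ sumFin-ι {D} _ ⟩
      ι (sumℤ {D} (λ j → ℤ.- coeff (drop 1 q) (toℕ j) ℤ.* + (Tᵢ ℕ.^ (1 ℕ.+ toℕ j))))
        ≡⟨ cong ι (momentSum D (drop 1 q) 1 Tᵢ (length-drop {D} q len)) ⟩
      ι (ℤ.- (+ (Tᵢ ℕ.^ 1) ℤ.* evalPoly (drop 1 q) (+ Tᵢ)))
        ≡⟨ cong ι (cong (λ x → ℤ.- (+ x ℤ.* evalPoly (drop 1 q) (+ Tᵢ))) (ℕ.*-identityʳ Tᵢ)) ⟩
      ι (ℤ.- (+ Tᵢ ℤ.* evalPoly (drop 1 q) (+ Tᵢ)))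
        ≡⟨ cong ι (rearrange (coeff q 0) (+ Tᵢ) (evalPoly (drop 1 q) (+ Tᵢ))) ⟩
      ι (coeff q 0 ℤ.- (coeff q 0 ℤ.+ + Tᵢ ℤ.* evalPoly (drop 1 q) (+ Tᵢ)))
        ≡⟨ cong (λ v → ι (coeff q 0 ℤ.- v)) (evalPoly-drop q (+ Tᵢ)) ⟨
      ι (coeff q 0 ℤ.- evalPoly q (parameter i)) ∎
      where
      Tᵢ : ℕ
      Tᵢ = suc (toℕ i)
      rearrange : ∀ a t E → ℤ.- (t ℤ.* E) ≡ a ℤ.- (a ℤ.+ t ℤ.* E)
      rearrange = solve-∀

    on-face : ∀ i → i ∈ S → eval c i ≡ ι (coeff q 0)
    on-face i i∈S = trans (eval≡ i)
      (cong ι (trans (cong (λ v → coeff q 0 ℤ.- v) (vanishes i i∈S)) (ℤ.+-identityʳ (coeff q 0))))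

    off-face : ∀ i → i ∉ S → eval c i ℚ.< ι (coeff q 0)
    off-face i i∉S = subst (ℚ._< ι (coeff q 0)) (sym (eval≡ i)) (ι-< (below (positive i i∉S)))
      where
      below : ∀ {h} → IsPositive h → coeff q 0 ℤ.- h ℤ.< coeff q 0
      below (k , refl) = subst (λ v → coeff q 0 ℤ.- +[1+ k ] ℤ.< v) (ℤ.+-identityʳ (coeff q 0))
                               (ℤ.+-monoʳ-< (coeff q 0) ℤ.-<+)

  face-of-squares : ∀ D (S R : Subset n) B → length B ℕ.+ (∣ R ∣ ℕ.+ ∣ R ∣) ≤ suc D → R ⊆ S →
    (∀ i → i ∈ S → i ∈ R ⊎ evalPoly B (parameter i) ≡ 0ℤ) →
    (∀ i → i ∉ S → IsPositive (evalPoly B (parameter i))) → IsFace D n S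
  face-of-squares {n = n} D S R B len R⊆S vanishes positive =
    face-of-polynomial D n S (squaresFrom 0 R B) (ℕ.≤-trans (length-squaresFrom 0 R B) len) vanishes′ positive′
    where
    vanishes′ : ∀ i → i ∈ S → evalPoly (squaresFrom 0 R B) (parameter i) ≡ 0ℤ
    vanishes′ i i∈S with vanishes i i∈S
    ... | inj₁ i∈R = trans (evalPoly-squaresFrom 0 R B (parameter i))
                           (trans (cong (evalPoly B (parameter i) ℤ.*_) (squaresValue-root 0 R i∈R refl))
                                  (ℤ.*-zeroʳ (evalPoly B (parameter i))))
    ... | inj₂ B≡0 = trans (evalPoly-squaresFrom 0 R B (parameter i))
                           (cong (ℤ._* squaresValue 0 R (parameter i)) B≡0)
    positive′ : ∀ i → i ∉ S → IsPositive (evalPoly (squaresFrom 0 R B) (parameter i))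
    positive′ i i∉S = subst IsPositive (sym (evalPoly-squaresFrom 0 R B (parameter i)))
      (*-isPositive (positive i i∉S)
                    (squaresValue-positive 0 R (parameter i) λ j j∈R i≡j →
                       i∉S (subst (_∈ S) (sym (parameter-injective i≡j)) (R⊆S j∈R))))

  small-face : ∀ d (S : Subset n) → ∣ S ∣ ≤ d → IsFace (2 * d ℕ.+ 1) n S
  small-face d S ∣S∣≤d =
    face-of-squares _ S S (1ℤ ∷ []) (degree-bound {e = 1} (s≤s z≤n) (s≤s ∣S∣≤d)) (λ i∈S → i∈S)
      (λ _ i∈S → inj₁ i∈S) (λ i _ → subst IsPositive (sym (evalPoly-constant 1ℤ (parameter i))) (0 , refl))

  first-face : ∀ d (S : Subset n) → a ∈ S → toℕ a ≡ 0 → ∣ S ∣ ≤ suc d → IsFace (2 * d ℕ.+ 1) n S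
  first-face {a = a} d S a∈S a≡0 ∣S∣≤1+d =
    face-of-squares _ S (S - a) B
      (degree-bound {e = 1} (length-mulRoot 1ℤ (1ℤ ∷ []))
                    (subst (_≤ suc d) (sym (x∈p⇒1+∣p-x∣≡∣p∣ S a∈S)) ∣S∣≤1+d))
      x∈p-y⇒x∈p vanishes positive
    where
    B : List ℤ
    B = mulRoot 1ℤ (1ℤ ∷ [])
    B≡ : ∀ t → evalPoly B t ≡ t ℤ.- 1ℤ
    B≡ t = trans (evalPoly-mulRoot 1ℤ (1ℤ ∷ []) t)
                 (trans (cong ((t ℤ.- 1ℤ) ℤ.*_) (evalPoly-constant 1ℤ t)) (ℤ.*-identityʳ (t ℤ.- 1ℤ)))
    vanishes : ∀ i → i ∈ S → i ∈ S - a ⊎ evalPoly B (parameter i) ≡ 0ℤ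
    vanishes i i∈S with x∈p⇒x∈p-y⊎x≡y i∈S
    ... | inj₁ i∈S-a = inj₁ i∈S-a
    ... | inj₂ refl = inj₂ (trans (B≡ (parameter i)) (cong (λ k → + suc k ℤ.- 1ℤ) a≡0))
    positive : ∀ i → i ∉ S → IsPositive (evalPoly B (parameter i))
    positive i i∉S = subst IsPositive (sym (B≡ (parameter i)))
      (positive-difference (s≤s (ℕ.n≢0⇒n>0 λ i≡0 →
         i∉S (subst (_∈ S) (Fin.toℕ-injective (trans a≡0 (sym i≡0))) a∈S))))

  last-face : ∀ d (S : Subset n) → a ∈ S → suc (toℕ a) ≡ n → ∣ S ∣ ≤ suc d → IsFace (2 * d ℕ.+ 1) n S
  last-face {n = n} {a = a} d S a∈S 1+a≡n ∣S∣≤1+d =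
    face-of-squares _ S (S - a) B
      (degree-bound {e = 1} (length-mulRoot (+ n) (-1ℤ ∷ []))
                    (subst (_≤ suc d) (sym (x∈p⇒1+∣p-x∣≡∣p∣ S a∈S)) ∣S∣≤1+d))
      x∈p-y⇒x∈p vanishes positive
    where
    B : List ℤ
    B = mulRoot (+ n) (-1ℤ ∷ [])
    B≡ : ∀ t → evalPoly B t ≡ + n ℤ.- t
    B≡ t = trans (evalPoly-mulRoot (+ n) (-1ℤ ∷ []) t)
                 (trans (cong ((t ℤ.- + n) ℤ.*_) (evalPoly-constant -1ℤ t)) (flip t (+ n)))
      where
      flip : ∀ t n → (t ℤ.- n) ℤ.* -1ℤ ≡ n ℤ.- t
      flip = solve-∀
    vanishes : ∀ i → i ∈ S → i ∈ S - a ⊎ evalPoly B (parameter i) ≡ 0ℤ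
    vanishes i i∈S with x∈p⇒x∈p-y⊎x≡y i∈S
    ... | inj₁ i∈S-a = inj₁ i∈S-a
    ... | inj₂ refl = inj₂ (trans (B≡ (parameter i)) (trans (cong (λ k → + n ℤ.- + k) 1+a≡n) (ℤ.+-inverseʳ (+ n))))
    positive : ∀ i → i ∉ S → IsPositive (evalPoly B (parameter i))
    positive i i∉S = subst IsPositive (sym (B≡ (parameter i)))
      (positive-difference (ℕ.≤∧≢⇒< (Fin.toℕ<n i) λ 1+i≡n →
         i∉S (subst (_∈ S) (Fin.toℕ-injective (ℕ.suc-injective (trans 1+a≡n (sym 1+i≡n)))) a∈S)))

  product-of-consecutive-positive : ∀ x → x ≢ 0ℤ → x ≢ 1ℤ → IsPositive (x ℤ.* (x ℤ.- 1ℤ))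
  product-of-consecutive-positive (+ 0)             x≢0 _   = ⊥-elim (x≢0 refl)
  product-of-consecutive-positive (+ 1)             _   x≢1 = ⊥-elim (x≢1 refl)
  product-of-consecutive-positive (+ suc (suc k))   _   _   = _ , refl
  product-of-consecutive-positive -[1+ k ]          _   _   = _ , refl

  consecutive-face : ∀ d (S : Subset n) → a ∈ S → b ∈ S → toℕ b ≡ suc (toℕ a) → ∣ S ∣ ≤ suc d →
    IsFace (2 * d ℕ.+ 1) n S
  consecutive-face {a = a} {b = b} d S a∈S b∈S b≡1+a ∣S∣≤1+d =
    face-of-squares _ S R B
      (degree-bound {e = 2} (ℕ.≤-trans (length-mulRoot (parameter a) (mulRoot (parameter b) (1ℤ ∷ [])))
                                       (s≤s (ℕ.m≤n⇒m≤1+n (length-mulRoot (parameter b) (1ℤ ∷ [])))))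
                    (subst (_≤ suc d) (sym ∣R∣+2≡∣S∣) ∣S∣≤1+d))
      (x∈p-y⇒x∈p ∘ x∈p-y⇒x∈p) vanishes positive
    where
    R : Subset _
    R = S - a - b
    B : List ℤ
    B = mulRoot (parameter a) (mulRoot (parameter b) (1ℤ ∷ []))
    b∈S-a : b ∈ S - a
    b∈S-a = x∈p∧x≢y⇒x∈p-y b∈S (λ b≡a → ℕ.1+n≢n (trans (sym b≡1+a) (cong toℕ b≡a)))
    ∣R∣+2≡∣S∣ : suc (suc ∣ R ∣) ≡ ∣ S ∣
    ∣R∣+2≡∣S∣ = trans (cong suc (x∈p⇒1+∣p-x∣≡∣p∣ (S - a) b∈S-a)) (x∈p⇒1+∣p-x∣≡∣p∣ S a∈S)
    parameter-b : parameter b ≡ 1ℤ ℤ.+ parameter a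
    parameter-b = trans (cong (λ k → + suc k) b≡1+a) (ℤ.pos-+ 1 (suc (toℕ a)))
    B≡ : ∀ t → evalPoly B t ≡ (t ℤ.- parameter a) ℤ.* ((t ℤ.- parameter a) ℤ.- 1ℤ)
    B≡ t = begin
      evalPoly B t
        ≡⟨ evalPoly-mulRoot (parameter a) (mulRoot (parameter b) (1ℤ ∷ [])) t ⟩
      (t ℤ.- parameter a) ℤ.* evalPoly (mulRoot (parameter b) (1ℤ ∷ [])) t
        ≡⟨ cong ((t ℤ.- parameter a) ℤ.*_) (trans (evalPoly-mulRoot (parameter b) (1ℤ ∷ []) t)
                                              (cong ((t ℤ.- parameter b) ℤ.*_) (evalPoly-constant 1ℤ t))) ⟩
      (t ℤ.- parameter a) ℤ.* ((t ℤ.- parameter b) ℤ.* 1ℤ)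
        ≡⟨ cong (λ p → (t ℤ.- parameter a) ℤ.* ((t ℤ.- p) ℤ.* 1ℤ)) parameter-b ⟩
      (t ℤ.- parameter a) ℤ.* ((t ℤ.- (1ℤ ℤ.+ parameter a)) ℤ.* 1ℤ)
        ≡⟨ shift-root t (parameter a) ⟩
      (t ℤ.- parameter a) ℤ.* ((t ℤ.- parameter a) ℤ.- 1ℤ) ∎
      where
      shift-root : ∀ t p → (t ℤ.- p) ℤ.* ((t ℤ.- (1ℤ ℤ.+ p)) ℤ.* 1ℤ) ≡ (t ℤ.- p) ℤ.* ((t ℤ.- p) ℤ.- 1ℤ)
      shift-root = solve-∀
    b-a≡1 : parameter b ℤ.- parameter a ≡ 1ℤ
    b-a≡1 = trans (cong (ℤ._- parameter a) parameter-b) (cancel (parameter a))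
      where
      cancel : ∀ p → (1ℤ ℤ.+ p) ℤ.- p ≡ 1ℤ
      cancel = solve-∀
    vanishes : ∀ i → i ∈ S → i ∈ R ⊎ evalPoly B (parameter i) ≡ 0ℤ
    vanishes i i∈S with x∈p⇒x∈p-y⊎x≡y {y = a} i∈S
    ... | inj₂ refl = inj₂ (trans (B≡ (parameter i)) (cong (λ x → x ℤ.* (x ℤ.- 1ℤ)) (ℤ.+-inverseʳ (parameter i))))
    ... | inj₁ i∈S-a with x∈p⇒x∈p-y⊎x≡y {y = b} i∈S-a
    ...   | inj₁ i∈R = inj₁ i∈R
    ...   | inj₂ refl = inj₂ (trans (B≡ (parameter i)) (cong (λ x → x ℤ.* (x ℤ.- 1ℤ)) b-a≡1))
    positive : ∀ i → i ∉ S → IsPositive (evalPoly B (parameter i))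
    positive i i∉S = subst IsPositive (sym (B≡ (parameter i))) (product-of-consecutive-positive _ i≢a i≢b)
      where
      i≢a : parameter i ℤ.- parameter a ≢ 0ℤ
      i≢a i-a≡0 = i∉S (subst (_∈ S) (sym (parameter-injective (ℤ.i-j≡0⇒i≡j _ _ i-a≡0))) a∈S)
      i≢b : parameter i ℤ.- parameter a ≢ 1ℤ
      i≢b i-a≡1 = i∉S (subst (_∈ S) (sym (parameter-injective i≡b)) b∈S)
        where
        recover : ∀ t p → t ≡ (t ℤ.- p) ℤ.+ p
        recover = solve-∀
        i≡b : parameter i ≡ parameter b
        i≡b = trans (recover (parameter i) (parameter a))
                    (trans (cong (ℤ._+ parameter a) i-a≡1) (sym parameter-b))

open CyclicPolytopeFaces using (small-face; first-face; last-face; consecutive-face)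

anchored-⊤-face : Anchored ⊤ S → ∣ S ∣ ≤ suc d → IsFace (2 * d + 1) n S
anchored-⊤-face {S = S} {d = d} S-anchored ∣S∣≤1+d with anchored-⊤⇒pathAnchored S-anchored
... | first a∈S a≡0               = first-face d S a∈S a≡0 ∣S∣≤1+d
... | last a∈S 1+a≡n              = last-face d S a∈S 1+a≡n ∣S∣≤1+d
... | consecutive a∈S b∈S b≡1+a   = consecutive-face d S a∈S b∈S b≡1+a ∣S∣≤1+d

small⇒≢⊤ : ∀ {S : Subset n} → suc d ℕ.< n → ∣ S ∣ ≤ suc d → S ≢ ⊤
small⇒≢⊤ {n = n} 1+d<n ∣S∣≤1+d refl = ℕ.<⇒≱ 1+d<n (subst (_≤ _) (∣⊤∣≡n n) ∣S∣≤1+d)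

anchoredComplex-⊤⊑ : suc d ℕ.< n →
  AnchoredComplex d M ⊤ ⊑ AddFace (Skeleton d (BoundaryComplex (2 * d + 1) n)) M
anchoredComplex-⊤⊑ {d = d} 1+d<n S (_ , ∣S∣≤1+d , small ∣S∣≤d) =
  inj₁ ((small-face d S ∣S∣≤d , small⇒≢⊤ 1+d<n ∣S∣≤1+d) , ∣S∣≤1+d)
anchoredComplex-⊤⊑ 1+d<n S (_ , ∣S∣≤1+d , anchored S-anchored) =
  inj₁ ((anchored-⊤-face S-anchored ∣S∣≤1+d , small⇒≢⊤ 1+d<n ∣S∣≤1+d) , ∣S∣≤1+d)
anchoredComplex-⊤⊑ 1+d<n S (_ , _ , missing S≡M) = inj₂ S≡M

2d+3≤n⇒1+d<n : 2 * d + 3 ≤ n → suc d ℕ.< n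
2d+3≤n⇒1+d<n {d = d} = ℕ.≤-trans (subst (suc (suc d) ≤_) (arithmetic d) (ℕ.m≤m+n (suc (suc d)) (suc d)))
  where
  arithmetic : ∀ d → suc (suc d) + suc d ≡ 2 * d + 3
  arithmetic = ℕ-Solver.solve-∀

1+double-suc : ∀ d → suc (double (suc d)) ≡ 2 * d + 3
1+double-suc d = trans (cong (λ k → suc (suc (suc k))) (double≡k+k d)) (arithmetic d)
  where
  arithmetic : ∀ d → suc (suc (suc (d + d))) ≡ 2 * d + 3
  arithmetic = ℕ-Solver.solve-∀

missingFace⇒¬pathAnchored : suc d ℕ.< n → MissingFace (BoundaryComplex (2 * d + 1) n) d M → ¬ PathAnchored M
missingFace⇒¬pathAnchored 1+d<n (∣M∣≡1+d , M∉∂C , _) M-anchored =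
  M∉∂C (anchored-⊤-face (pathAnchored⇒anchored-⊤ M-anchored) ∣M∣≤1+d , small⇒≢⊤ 1+d<n ∣M∣≤1+d)
  where
  ∣M∣≤1+d = ℕ.≤-reflexive ∣M∣≡1+d

mainTheorem10 : (d n : ℕ) → 1 ≤ d → 2 * d + 3 ≤ n → (M : Subset n) →
    MissingFace (BoundaryComplex (2 * d + 1) n) d M →
    IsMinor (SimplexSkeleton (2 * d + 3) d)
            (AddFace (Skeleton d (BoundaryComplex (2 * d + 1) n)) M)
mainTheorem10 d zero 1≤d 2d+3≤0 M _ = ⊥-elim (ℕ.n≮0 (2d+3≤n⇒1+d<n {d = d} 2d+3≤0))
mainTheorem10 d (suc m) 1≤d 2d+3≤n M M-missing@(∣M∣≡1+d , _ , _) =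
  AnchoredComplex d M (frame M) ,
  step (deletion anchoredComplex-isComplex (anchoredComplex-⊤⊑ 1+d<n))
       (contract-to-subset 1≤d (On.wellFounded ∣_∣ ℕ.<-wellFounded ⊤) ⊆⊤ (M⊆frame M) (zero∈frame M)) ,
  subst (λ k → Isomorphic (AnchoredComplex d M (frame M)) (SimplexSkeleton k d)) (trans ∣F∣≡ (1+double-suc d))
        (anchoredComplex≅skeleton ∣F∣≡ (M⊆frame M) ∣M∣≡1+d (¬anchored-frame ¬M-anchored))
  where
  1+d<n : suc d ℕ.< suc m
  1+d<n = 2d+3≤n⇒1+d<n {d = d} 2d+3≤n
  ¬M-anchored : ¬ PathAnchored M
  ¬M-anchored = missingFace⇒¬pathAnchored 1+d<n M-missing
  ∣F∣≡ : ∣ frame M ∣ ≡ suc (double (suc d))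
  ∣F∣≡ = trans (∣frame∣ ¬M-anchored) (cong (λ k → suc (double k)) ∣M∣≡1+d)
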